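{- Let $\mathcal{U}$ be the variety defined below. Then: (1) $\mathcal{U}$ is an abelian Mal'cev variety. (2) The ring $\mathbf{R}_\mathcal{U}$ is the free (unital, noncommutative) ring over the generators $r_1,\ldots,r_n$ (i.e. over the elements $r_1(x,z),\ldots,r_n(x,z)$). (3) The $\mathbf{R}_\mathcal{U}$-module $\mathbf{M}_\mathcal{U}$ is the free $\mathbf{R}_\mathcal{U}$-module over the generators $u_1,\ldots,u_\ell$ (i.e. over $u_1(z),\ldots,u_\ell(z)$). (4) A congruence $\theta$ on $\mathbf{F}_\mathcal{U}(x,z)$ is fully invariant if and only if, writing $I:=z/\theta\cap R_\mathcal{U}$ and $N:=z/\theta\cap M_\mathcal{U}$: (a) $I$ is an ideal of $\mathbf{R}_\mathcal{U}$; (b) $N$ is an $\mathbf{R}_\mathcal{U}$-submodule of $\mathbf{M}_\mathcal{U}$; (c) $z/\theta=I+N$; (d) $IM_\mathcal{U}\subseteq N$; (e) $f(x)-f(z)-x\in I$ for all $f(z)\in N$. (5) A fully invariant congruence $\theta$ on $\mathbf{F}_\mathcal{U}(x,z)$ is finitely generated (as a fully invariant congruence) if and only if the ideal $I:=z/\theta\cap R_\mathcal{U}$ of $\mathbf{R}_\mathcal{U}$ is finitely generated and, for $N:=z/\theta\cap M_\mathcal{U}$, the $\mathbf{R}_\mathcal{U}$-module $N/IM_\mathcal{U}$ is finitely generated.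
   Context: $\mathcal{U}$ is the variety of type $\{u_1,\ldots,u_\ell,r_1,\ldots,r_n,m\}$ with $\ell\le n$, $u_i$ unary, $r_i$ binary, $m$ ternary, defined by: (U1) $m(x,z,z)\approx m(z,z,x)\approx x$; (U2) $m(m(x_1,x_2,x_3),m(y_1,y_2,y_3),m(z_1,z_2,z_3))\approx m(m(x_1,y_1,z_1),m(x_2,y_2,z_2),m(x_3,y_3,z_3))$; (U3) $r_i(z,z)\approx z$ for $i\le n$; (U4) $m(r_i(x_1,x_2),r_i(y_1,y_2),r_i(z_1,z_2))\approx r_i(m(x_1,y_1,z_1),m(x_2,y_2,z_2))$ for $i\le n$; (U5) $m(u_i(x),u_i(y),u_i(z))\approx u_i(m(x,y,z))$ for $i\le\ell$; (U6) $m(u_i(x),u_i(z),z)\approx r_i(x,z)$ for $i\le\ell$. A variety is Mal'cev if it has a term $m$ with $m(x,x,y)\approx y\approx m(y,x,x)$, and abelian if each member $\mathbf{A}$ satisfies $[1_\mathbf{A},1_\mathbf{A}]=0_\mathbf{A}$. $\mathbf{F}_\mathcal{U}(x,z)$ is the free algebra of $\mathcal{U}$ on $x,z$ with universe $F_\mathcal{U}(x,z)$; $M_\mathcal{U}:=F_\mathcal{U}(z)\subseteq F_\mathcal{U}(x,z)$ (terms in $z$ only) and $R_\mathcal{U}:=F^{id}_\mathcal{U}(x,z)=\{t\in F_\mathcal{U}(x,z):t(z,z)=z\}$. On $F_\mathcal{U}(x,z)$ define $s+t:=m(s,z,t)$, $-s:=m(z,s,z)$, $s\cdot t:=s(t(x,z),z)$.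 Then $\mathbf{R}_\mathcal{U}=\langle R_\mathcal{U},+,-,\cdot\rangle$ is a ring with identity $x$ and zero $z$, and $\mathbf{M}_\mathcal{U}=\langle M_\mathcal{U},+,-\rangle$ is an $\mathbf{R}_\mathcal{U}$-module via $r\cdot v=r(v,z)$. For $f(z)\in M_\mathcal{U}$, $f(x)$ denotes the term obtained by substituting $x$ for $z$. $IM_\mathcal{U}$ denotes the set of finite sums of products $r\cdot v$ with $r\in I$, $v\in M_\mathcal{U}$. A congruence $\theta$ of an algebra $\mathbf{A}$ is fully invariant if it is preserved by every endomorphism of $\mathbf{A}$; a fully invariant congruence is finitely generated if it is the smallest fully invariant congruence containing some finite set of pairs. -}

module Defs where

open import Level using (Level; _⊔_; 0ℓ; Setω) renaming (suc to lsuc)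
open import Data.Nat using (ℕ; _≤_)
open import Data.Fin using (Fin; inject≤)
open import Data.Unit using (⊤)
open import Data.Product using (Σ; _×_; _,_; proj₁; proj₂; uncurry)
open import Data.Sum using (_⊎_; [_,_])
open import Data.List using (List; foldr; map; allFin)
open import Data.List.Relation.Unary.All using (All)
open import Data.List.Membership.Propositional using (_∈_)
open import Data.Vec.Functional using (_∷_; [])
open import Relation.Binary using (Setoid; IsEquivalence)
open import Algebra.Bundles using (Ring)
open import Function.Bundles using (_⇔_)

record Σω (A : Set) (B : A → Setω) : Setω where
  constructor _,ω_
  field
    fst : A
    snd : B fst

module Variety (ℓ n : ℕ) (ℓ≤n : ℓ ≤ n) where

  data Term (V : Set) : Set where
    var : V → Term V
    u   : Fin ℓ → Term V → Term V
    r   : Fin n → Term V → Term V → Term V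
    m   : Term V → Term V → Term V → Term V

  -- u_i is paired with r_i (i ≤ ℓ ≤ n)
  ι : Fin ℓ → Fin n
  ι i = inject≤ i ℓ≤n

  _⟪_⟫ : ∀ {V W : Set} → Term V → (V → Term W) → Term W
  var v     ⟪ σ ⟫ = σ v
  u i t     ⟪ σ ⟫ = u i (t ⟪ σ ⟫)
  r i s t   ⟪ σ ⟫ = r i (s ⟪ σ ⟫) (t ⟪ σ ⟫)
  m s t w   ⟪ σ ⟫ = m (s ⟪ σ ⟫) (t ⟪ σ ⟫) (w ⟪ σ ⟫)

  data Ax {V : Set} : Term V → Term V → Set where
    U1a : ∀ a c → Ax (m a c c) a
    U1b : ∀ a c → Ax (m c c a) a
    U2  : ∀ x₁ x₂ x₃ y₁ y₂ y₃ z₁ z₂ z₃ →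
          Ax (m (m x₁ x₂ x₃) (m y₁ y₂ y₃) (m z₁ z₂ z₃))
             (m (m x₁ y₁ z₁) (m x₂ y₂ z₂) (m x₃ y₃ z₃))
    U3  : ∀ i c → Ax (r i c c) c
    U4  : ∀ i x₁ x₂ y₁ y₂ z₁ z₂ →
          Ax (m (r i x₁ x₂) (r i y₁ y₂) (r i z₁ z₂)) (r i (m x₁ y₁ z₁) (m x₂ y₂ z₂))
    U5  : ∀ i a b c → Ax (m (u i a) (u i b) (u i c)) (u i (m a b c))
    U6  : ∀ i a c → Ax (m (u i a) (u i c) c) (r (ι i) a c)

  -- equational theory of 𝓤: the least congruence on terms containing all
  -- substitution instances of (U1)–(U6).  Term V / ≈U is the free algebra F_𝓤(V).
  infix 4 _≈U_
  data _≈U_ {V : Set} : Term V → Term V → Set where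
    ax     : ∀ {s t} → Ax s t → s ≈U t
    ≈refl  : ∀ {s} → s ≈U s
    ≈sym   : ∀ {s t} → s ≈U t → t ≈U s
    ≈trans : ∀ {s t w} → s ≈U t → t ≈U w → s ≈U w
    u-cong : ∀ i {s t} → s ≈U t → u i s ≈U u i t
    r-cong : ∀ i {s s' t t'} → s ≈U s' → t ≈U t' → r i s t ≈U r i s' t'
    m-cong : ∀ {s s' t t' w w'} → s ≈U s' → t ≈U t' → w ≈U w' → m s t w ≈U m s' t' w'

  record UAlgebra (c e : Level) : Set (lsuc (c ⊔ e)) where
    field
      setoid : Setoid c e
    open Setoid setoid using (Carrier; _≈_)
    field
      uᴬ : Fin ℓ → Carrier → Carrier
      rᴬ : Fin n → Carrier → Carrier → Carrier
      mᴬ : Carrier → Carrier → Carrier → Carrier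
      uᴬ-cong : ∀ i {a b} → a ≈ b → uᴬ i a ≈ uᴬ i b
      rᴬ-cong : ∀ i {a a' b b'} → a ≈ a' → b ≈ b' → rᴬ i a b ≈ rᴬ i a' b'
      mᴬ-cong : ∀ {a a' b b' d d'} → a ≈ a' → b ≈ b' → d ≈ d' → mᴬ a b d ≈ mᴬ a' b' d'
      U1aᴬ : ∀ a c → mᴬ a c c ≈ a
      U1bᴬ : ∀ a c → mᴬ c c a ≈ a
      U2ᴬ  : ∀ x₁ x₂ x₃ y₁ y₂ y₃ z₁ z₂ z₃ →
            mᴬ (mᴬ x₁ x₂ x₃) (mᴬ y₁ y₂ y₃) (mᴬ z₁ z₂ z₃)
              ≈ mᴬ (mᴬ x₁ y₁ z₁) (mᴬ x₂ y₂ z₂) (mᴬ x₃ y₃ z₃)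
      U3ᴬ  : ∀ i c → rᴬ i c c ≈ c
      U4ᴬ  : ∀ i x₁ x₂ y₁ y₂ z₁ z₂ →
            mᴬ (rᴬ i x₁ x₂) (rᴬ i y₁ y₂) (rᴬ i z₁ z₂) ≈ rᴬ i (mᴬ x₁ y₁ z₁) (mᴬ x₂ y₂ z₂)
      U5ᴬ  : ∀ i a b c → mᴬ (uᴬ i a) (uᴬ i b) (uᴬ i c) ≈ uᴬ i (mᴬ a b c)
      U6ᴬ  : ∀ i a c → mᴬ (uᴬ i a) (uᴬ i c) c ≈ rᴬ (ι i) a c

  module _ {c e : Level} (A : UAlgebra c e) where
    open UAlgebra A
    open Setoid setoid using (Carrier; _≈_)

    ⟦_⟧ : ∀ {V : Set} → Term V → (V → Carrier) → Carrier
    ⟦ var v ⟧   ρ = ρ v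
    ⟦ u i t ⟧   ρ = uᴬ i (⟦ t ⟧ ρ)
    ⟦ r i s t ⟧ ρ = rᴬ i (⟦ s ⟧ ρ) (⟦ t ⟧ ρ)
    ⟦ m s t w ⟧ ρ = mᴬ (⟦ s ⟧ ρ) (⟦ t ⟧ ρ) (⟦ w ⟧ ρ)

    -- [1_A , 1_A] = 0_A, i.e. C(1,1;0): the term condition
    IsAbelianAlg : Set (c ⊔ e)
    IsAbelianAlg = ∀ (p q : ℕ) (t : Term (Fin p ⊎ Fin q))
                     (a b : Fin p → Carrier) (a' b' : Fin q → Carrier) →
                     ⟦ t ⟧ [ a , a' ] ≈ ⟦ t ⟧ [ a , b' ] →
                     ⟦ t ⟧ [ b , a' ] ≈ ⟦ t ⟧ [ b , b' ]

    MalcevIn : Term (Fin 3) → Set (c ⊔ e)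
    MalcevIn p = ∀ a b → (⟦ p ⟧ (a ∷ a ∷ b ∷ []) ≈ b) × (⟦ p ⟧ (b ∷ a ∷ a ∷ []) ≈ b)

  IsMalcevVariety : Setω
  IsMalcevVariety = Σω (Term (Fin 3)) λ p → ∀ {c e} (A : UAlgebra c e) → MalcevIn A p

  IsAbelianVariety : Setω
  IsAbelianVariety = ∀ {c e} (A : UAlgebra c e) → IsAbelianAlg A

  data XZ : Set where
    vx vz : XZ

  F : Set
  F = Term XZ

  X Z : F
  X = var vx
  Z = var vz

  _⊕_ : F → F → F
  s ⊕ t = m s Z t

  ⊖_ : F → F
  ⊖ s = m Z s Z

  _⊙_ : F → F → F
  s ⊙ t = s ⟪ (λ { vx → t ; vz → Z }) ⟫

  InR : F → Set
  InR t = t ⟪ (λ _ → Z) ⟫ ≈U Z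

  -- M_𝓤 = F_𝓤(z) ⊆ F_𝓤(x,z): elements represented by a term in z only
  InM : F → Set
  InM t = Σ (Term ⊤) λ s → t ≈U s ⟪ (λ _ → Z) ⟫

  atX : F → F
  atX f = f ⟪ (λ _ → X) ⟫

  sumF : List F → F
  sumF = foldr _⊕_ Z

  module _ {c e : Level} (S : Ring c e) (g : Fin n → Ring.Carrier S) where
    open Ring S

    RMap : Set c
    RMap = (t : F) → InR t → Carrier

    record IsExtendingHom (φ : RMap) : Set (c ⊔ e) where
      field
        well-defined : ∀ s t (p : InR s) (q : InR t) → s ≈U t → φ s p ≈ φ t q
        hom-+ : ∀ s t (p : InR s) (q : InR t) (w : InR (s ⊕ t)) → φ (s ⊕ t) w ≈ φ s p + φ t q
        hom-* : ∀ s t (p : InR s) (q : InR t) (w : InR (s ⊙ t)) → φ (s ⊙ t) w ≈ φ s p * φ t q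
        hom-1 : ∀ (w : InR X) → φ X w ≈ 1#
        extends : ∀ i (w : InR (r i X Z)) → φ (r i X Z) w ≈ g i

    UniqueExtension : Set (c ⊔ e)
    UniqueExtension = Σ RMap λ φ → IsExtendingHom φ ×
                        (∀ ψ → IsExtendingHom ψ → ∀ t (p : InR t) → ψ t p ≈ φ t p)

  RIsFreeRing : Setω
  RIsFreeRing = ∀ {c e} (S : Ring c e) (g : Fin n → Ring.Carrier S) → UniqueExtension S g

  linComb : (Fin ℓ → F) → F
  linComb a = sumF (map (λ i → a i ⊙ u i Z) (allFin ℓ))

  MIsFreeModule : Set
  MIsFreeModule =
    (∀ v → InM v → Σ (Fin ℓ → F) λ a → (∀ i → InR (a i)) × (v ≈U linComb a)) ×
    (∀ a b → (∀ i → InR (a i)) → (∀ i → InR (b i)) →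
       linComb a ≈U linComb b → ∀ i → a i ≈U b i)

  -- Congruences of F_𝓤(x,z) (as relations on representatives containing ≈U)

  Rel₀ : Set₁
  Rel₀ = F → F → Set

  record IsCongruence (θ : Rel₀) : Set where
    field
      isEquivalence : IsEquivalence θ
      contains-≈U   : ∀ {s t} → s ≈U t → θ s t
      u-comp : ∀ i {s t} → θ s t → θ (u i s) (u i t)
      r-comp : ∀ i {s s' t t'} → θ s s' → θ t t' → θ (r i s t) (r i s' t')
      m-comp : ∀ {s s' t t' w w'} → θ s s' → θ t t' → θ w w' → θ (m s t w) (m s' t' w')

  record IsEndo (f : F → F) : Set where
    field
      well-defined : ∀ {s t} → s ≈U t → f s ≈U f t
      hom-u : ∀ i s → f (u i s) ≈U u i (f s)
      hom-r : ∀ i s t → f (r i s t) ≈U r i (f s) (f t)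
      hom-m : ∀ s t w → f (m s t w) ≈U m (f s) (f t) (f w)

  FullyInvariant : Rel₀ → Set
  FullyInvariant θ = ∀ f → IsEndo f → ∀ {s t} → θ s t → θ (f s) (f t)

  record IsIdeal (P : F → Set) : Set where
    field
      ⊆R    : ∀ t → P t → InR t
      resp  : ∀ s t → s ≈U t → P s → P t
      zero  : P Z
      +-cl  : ∀ s t → P s → P t → P (s ⊕ t)
      neg-cl : ∀ s → P s → P (⊖ s)
      left-cl  : ∀ a s → InR a → P s → P (a ⊙ s)
      right-cl : ∀ a s → InR a → P s → P (s ⊙ a)

  -- R_𝓤-submodules of M_𝓤 (module action r·v = r(v,z) = r ⊙ v)
  record IsSubmodule (P : F → Set) : Set where
    field
      ⊆M    : ∀ t → P t → InM t
      resp  : ∀ s t → s ≈U t → P s → P t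
      zero  : P Z
      +-cl  : ∀ s t → P s → P t → P (s ⊕ t)
      neg-cl : ∀ s → P s → P (⊖ s)
      act-cl : ∀ a v → InR a → P v → P (a ⊙ v)

  sumProd : List (F × F) → F
  sumProd l = sumF (map (λ p → proj₁ p ⊙ proj₂ p) l)

  InIM : (F → Set) → F → Set
  InIM I t = Σ (List (F × F)) λ l →
               All (λ p → I (proj₁ p) × InM (proj₂ p)) l × (t ≈U sumProd l)

  Iθ : Rel₀ → F → Set
  Iθ θ t = θ Z t × InR t

  Nθ : Rel₀ → F → Set
  Nθ θ t = θ Z t × InM t

  Conditions : Rel₀ → Set
  Conditions θ =
    IsIdeal (Iθ θ) ×
    IsSubmodule (Nθ θ) ×
    (∀ t → θ Z t ⇔ (Σ F λ a → Σ F λ b → Iθ θ a × Nθ θ b × (t ≈U a ⊕ b))) ×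
    (∀ t → InIM (Iθ θ) t → Nθ θ t) ×
    (∀ f → Nθ θ f → Iθ θ ((atX f ⊕ (⊖ f)) ⊕ (⊖ X)))

  Part4 : Set₁
  Part4 = ∀ θ → IsCongruence θ → (FullyInvariant θ ⇔ Conditions θ)

  FinGenFI : Rel₀ → Set₁
  FinGenFI θ = Σ (List (F × F)) λ L → All (uncurry θ) L ×
                 (∀ ψ → IsCongruence ψ → FullyInvariant ψ → All (uncurry ψ) L →
                    ∀ s t → θ s t → ψ s t)

  FinGenIdeal : (F → Set) → Set₁
  FinGenIdeal P = Σ (List F) λ G → All P G ×
                    (∀ J → IsIdeal J → All J G → ∀ t → P t → J t)

  -- N / I M_𝓤 is finitely generated: finitely many g ∈ N whose cosets span,
  -- i.e. every t ∈ N satisfies t - Σ rⱼ·gⱼ ∈ I M_𝓤 for some rⱼ ∈ R_𝓤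
  FinGenQuotient : (F → Set) → (F → Set) → Set
  FinGenQuotient N I = Σ (List F) λ G → All N G ×
    (∀ t → N t → Σ (List (F × F)) λ l →
       All (λ p → InR (proj₁ p) × proj₂ p ∈ G) l × InIM I (t ⊕ (⊖ sumProd l)))

  Part5 : Set₁
  Part5 = ∀ θ → IsCongruence θ → FullyInvariant θ →
            (FinGenFI θ ⇔ (FinGenIdeal (Iθ θ) × FinGenQuotient (Nθ θ) (Iθ θ)))

  record Lemma3p2 : Setω where
    field
      part1-malcev   : IsMalcevVariety
      part1-abelian  : IsAbelianVariety
      part2          : RIsFreeRing
      part3          : MIsFreeModule
      part4          : Part4
      part5          : Part5

module Submission where

open import Defs
open import Data.Nat using (ℕ; _≤_)
open import Algebra.Bundles using (AbelianGroup)

-- Every member of 𝓤 is an abelian group for any origin o, with m(a, b, d) = a − b + d, and every basic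
-- operation commutes with m; so term operations are affine, which gives (1). In F_𝓤(x, z) every t splits
-- as (t − t(z, z)) + t(z, z) ∈ R_𝓤 ⊕ M_𝓤. Freeness in (2) and (3) is witnessed by two members of 𝓤: a ring S
-- with r_i(a, b) = g_i a + (1 − g_i) b, where evaluation at x = 1, z = 0 is the extension, and R_𝓤^ℓ with
-- u_j(v) = r_(ι j)·v + e_j, where evaluation at 0 reads off coordinates. For (4), conditions (a)–(e) are
-- exactly what makes "s − t ∈ I + N" invariant under the endomorphism x ↦ p, z ↦ q: it sends a ∈ I to
-- a·(p − q) + q and b ∈ N to b + defect(b)·q + q, where defect(b) = b(x) − b(z) − x. For (5), each
-- generating pair (s, t) of θ contributes the R_𝓤-part of s − t and the defect of its M_𝓤-part to the
-- generators of I, and that M_𝓤-part to the generators of N modulo I M_𝓤; conversely the pairs (z, g) for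
-- such generators g generate θ.

module AbelianGroupSolver {a ℓ} (G : AbelianGroup a ℓ) where

  open import Data.Nat using (ℕ; zero; suc; _+_; _≟_; _<?_)
  open import Data.Nat.Properties using (+-comm)
  open import Data.Fin using (Fin; zero; suc; #_)
  open import Data.Fin.Properties using (all?) renaming (_≟_ to _≟ᶠ_)
  open import Data.Product using (_×_; _,_; proj₁; proj₂; swap)
  open import Data.Vec using (Vec; lookup)
  open import Data.Vec.Functional using (head; tail)
  open import Function using (_∘_)
  open import Data.Bool using (if_then_else_)
  open import Relation.Nullary using (Dec; does)
  open import Relation.Nullary.Decidable using (True; toWitness)
  open import Relation.Binary.PropositionalEquality as ≡ using (_≡_)

  open AbelianGroup G
  open import Algebra.Properties.AbelianGroup G using (⁻¹-∙-comm; ε⁻¹≈ε; ⁻¹-involutive)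
  open import Algebra.Properties.CommutativeSemigroup commutativeSemigroup using (interchange)
  open import Algebra.Properties.Monoid.Mult monoid using (×-homo-1; ×-homo-+)
    renaming (_×_ to _·_)
  open import Relation.Binary.Reasoning.Setoid setoid

  infixl 6 _⊞_
  infix 7 ⊟_

  data Expr (k : ℕ) : Set where
    var : Fin k → Expr k
    ε̂   : Expr k
    _⊞_ : Expr k → Expr k → Expr k
    ⊟_  : Expr k → Expr k

  ‵_ : ∀ {k} (i : ℕ) {i<k : True (i <? k)} → Expr k
  ‵_ i {i<k} = var ((# i) {m<n = i<k})

  ⟦_⟧ : ∀ {k} → Expr k → (Fin k → Carrier) → Carrier
  ⟦ var i ⟧ ρ = ρ i
  ⟦ ε̂ ⟧     ρ = ε
  ⟦ e ⊞ f ⟧ ρ = ⟦ e ⟧ ρ ∙ ⟦ f ⟧ ρ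
  ⟦ ⊟ e ⟧   ρ = ⟦ e ⟧ ρ ⁻¹

  Coefficient : Set
  Coefficient = ℕ × ℕ

  Normal : ℕ → Set
  Normal k = Fin k → Coefficient

  ⟦_⟧ᶜ : Coefficient → Carrier → Carrier
  ⟦ p , q ⟧ᶜ x = p · x ∙ (q · x) ⁻¹

  ⟦_⟧ₙ : ∀ {k} → Normal k → (Fin k → Carrier) → Carrier
  ⟦_⟧ₙ {zero}  f ρ = ε
  ⟦_⟧ₙ {suc k} f ρ = ⟦ head f ⟧ᶜ (head ρ) ∙ ⟦ tail f ⟧ₙ (tail ρ)

  _+ᶜ_ : Coefficient → Coefficient → Coefficient
  (p , q) +ᶜ (p′ , q′) = p + p′ , q + q′

  normalise : ∀ {k} → Expr k → Normal k
  normalise (var i) j = if does (i ≟ᶠ j) then (1 , 0) else (0 , 0)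
  normalise ε̂       j = 0 , 0
  normalise (e ⊞ f) j = normalise e j +ᶜ normalise f j
  normalise (⊟ e)   j = swap (normalise e j)

  ⟦⟧ᶜ-+ : ∀ c d x → ⟦ c +ᶜ d ⟧ᶜ x ≈ ⟦ c ⟧ᶜ x ∙ ⟦ d ⟧ᶜ x
  ⟦⟧ᶜ-+ (p , q) (p′ , q′) x = begin
    (p + p′) · x ∙ ((q + q′) · x) ⁻¹              ≈⟨ ∙-cong (×-homo-+ x p p′) (⁻¹-cong (×-homo-+ x q q′)) ⟩
    (p · x ∙ p′ · x) ∙ (q · x ∙ q′ · x) ⁻¹         ≈⟨ ∙-congˡ (sym (⁻¹-∙-comm _ _)) ⟩
    (p · x ∙ p′ · x) ∙ ((q · x) ⁻¹ ∙ (q′ · x) ⁻¹) ≈⟨ interchange _ _ _ _ ⟩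
    ⟦ p , q ⟧ᶜ x ∙ ⟦ p′ , q′ ⟧ᶜ x                  ∎

  ⟦⟧ᶜ-swap : ∀ p q x → ⟦ q , p ⟧ᶜ x ≈ ⟦ p , q ⟧ᶜ x ⁻¹
  ⟦⟧ᶜ-swap p q x = begin
    q · x ∙ (p · x) ⁻¹           ≈⟨ comm _ _ ⟩
    (p · x) ⁻¹ ∙ q · x           ≈⟨ ∙-congˡ (sym (⁻¹-involutive _)) ⟩
    (p · x) ⁻¹ ∙ (q · x) ⁻¹ ⁻¹   ≈⟨ ⁻¹-∙-comm _ _ ⟩
    (p · x ∙ (q · x) ⁻¹) ⁻¹      ∎

  ⟦⟧ᶜ-diagonal : ∀ p x → ⟦ p , p ⟧ᶜ x ≈ ε
  ⟦⟧ᶜ-diagonal p x = inverseʳ (p · x)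

  Balanced : Coefficient → Coefficient → Set
  Balanced (p , q) (p′ , q′) = p + q′ ≡ p′ + q

  ⟦⟧ᶜ-balanced : ∀ c d x → Balanced c d → ⟦ c ⟧ᶜ x ≈ ⟦ d ⟧ᶜ x
  ⟦⟧ᶜ-balanced (p , q) (p′ , q′) x p+q′≡p′+q = begin
    ⟦ p , q ⟧ᶜ x                          ≈⟨ sym (identityʳ _) ⟩
    ⟦ p , q ⟧ᶜ x ∙ ε                      ≈⟨ ∙-congˡ (sym (⟦⟧ᶜ-diagonal q′ x)) ⟩
    ⟦ p , q ⟧ᶜ x ∙ ⟦ q′ , q′ ⟧ᶜ x         ≈⟨ sym (⟦⟧ᶜ-+ (p , q) (q′ , q′) x) ⟩
    ⟦ p + q′ , q + q′ ⟧ᶜ x                ≡⟨ ≡.cong₂ (λ s t → ⟦ s , t ⟧ᶜ x) p+q′≡p′+q (+-comm q q′) ⟩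
    ⟦ p′ + q , q′ + q ⟧ᶜ x                ≈⟨ ⟦⟧ᶜ-+ (p′ , q′) (q , q) x ⟩
    ⟦ p′ , q′ ⟧ᶜ x ∙ ⟦ q , q ⟧ᶜ x         ≈⟨ ∙-congˡ (⟦⟧ᶜ-diagonal q x) ⟩
    ⟦ p′ , q′ ⟧ᶜ x ∙ ε                    ≈⟨ identityʳ _ ⟩
    ⟦ p′ , q′ ⟧ᶜ x                        ∎

  ⟦⟧ₙ-zero : ∀ {k} ρ → ⟦ (λ (_ : Fin k) → 0 , 0) ⟧ₙ ρ ≈ ε
  ⟦⟧ₙ-zero {zero}  ρ = refl
  ⟦⟧ₙ-zero {suc k} ρ = trans (∙-cong (⟦⟧ᶜ-diagonal 0 (head ρ)) (⟦⟧ₙ-zero (tail ρ))) (identityˡ ε)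

  ⟦⟧ₙ-+ : ∀ {k} (f g : Normal k) ρ → ⟦ (λ j → f j +ᶜ g j) ⟧ₙ ρ ≈ ⟦ f ⟧ₙ ρ ∙ ⟦ g ⟧ₙ ρ
  ⟦⟧ₙ-+ {zero}  f g ρ = sym (identityʳ ε)
  ⟦⟧ₙ-+ {suc k} f g ρ =
    trans (∙-cong (⟦⟧ᶜ-+ (head f) (head g) (head ρ)) (⟦⟧ₙ-+ (tail f) (tail g) (tail ρ))) (interchange _ _ _ _)

  ⟦⟧ₙ-swap : ∀ {k} (f : Normal k) ρ → ⟦ swap ∘ f ⟧ₙ ρ ≈ ⟦ f ⟧ₙ ρ ⁻¹
  ⟦⟧ₙ-swap {zero}  f ρ = sym ε⁻¹≈ε
  ⟦⟧ₙ-swap {suc k} f ρ =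
    trans (∙-cong (⟦⟧ᶜ-swap (proj₁ (head f)) (proj₂ (head f)) (head ρ)) (⟦⟧ₙ-swap (tail f) (tail ρ))) (⁻¹-∙-comm _ _)

  ⟦⟧ₙ-var : ∀ {k} (i : Fin k) ρ → ⟦ normalise (var i) ⟧ₙ ρ ≈ ρ i
  ⟦⟧ₙ-var {suc k} zero ρ = begin
    ⟦ 1 , 0 ⟧ᶜ (ρ zero) ∙ ⟦ (λ (_ : Fin k) → 0 , 0) ⟧ₙ (tail ρ)
      ≈⟨ ∙-cong (∙-cong (×-homo-1 _) ε⁻¹≈ε) (⟦⟧ₙ-zero (tail ρ)) ⟩
    (ρ zero ∙ ε) ∙ ε
      ≈⟨ trans (identityʳ _) (identityʳ _) ⟩
    ρ zero
      ∎
  ⟦⟧ₙ-var {suc k} (suc i) ρ = trans (∙-cong (⟦⟧ᶜ-diagonal 0 (head ρ)) (⟦⟧ₙ-var i (tail ρ))) (identityˡ _)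

  ⟦⟧ₙ-balanced : ∀ {k} (f g : Normal k) ρ → (∀ j → Balanced (f j) (g j)) → ⟦ f ⟧ₙ ρ ≈ ⟦ g ⟧ₙ ρ
  ⟦⟧ₙ-balanced {zero}  f g ρ bal = refl
  ⟦⟧ₙ-balanced {suc k} f g ρ bal =
    ∙-cong (⟦⟧ᶜ-balanced (head f) (head g) (head ρ) (bal zero)) (⟦⟧ₙ-balanced (tail f) (tail g) (tail ρ) (bal ∘ suc))

  normalise-correct : ∀ {k} (e : Expr k) ρ → ⟦ normalise e ⟧ₙ ρ ≈ ⟦ e ⟧ ρ
  normalise-correct (var i) ρ = ⟦⟧ₙ-var i ρ
  normalise-correct ε̂       ρ = ⟦⟧ₙ-zero ρ
  normalise-correct (e ⊞ f) ρ =
    trans (⟦⟧ₙ-+ (normalise e) (normalise f) ρ) (∙-cong (normalise-correct e ρ) (normalise-correct f ρ))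
  normalise-correct (⊟ e)   ρ = trans (⟦⟧ₙ-swap (normalise e) ρ) (⁻¹-cong (normalise-correct e ρ))

  balanced? : ∀ {k} (f g : Normal k) → Dec (∀ j → Balanced (f j) (g j))
  balanced? f g = all? λ j → proj₁ (f j) + proj₂ (g j) ≟ proj₁ (g j) + proj₂ (f j)

  solve : ∀ {k} (e f : Expr k) → True (balanced? (normalise e) (normalise f)) →
          ∀ (ρ : Vec Carrier k) → ⟦ e ⟧ (lookup ρ) ≈ ⟦ f ⟧ (lookup ρ)
  solve e f bal ρ = begin
    ⟦ e ⟧ (lookup ρ)             ≈⟨ normalise-correct e (lookup ρ) ⟨
    ⟦ normalise e ⟧ₙ (lookup ρ)  ≈⟨ ⟦⟧ₙ-balanced (normalise e) (normalise f) (lookup ρ) (toWitness bal) ⟩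
    ⟦ normalise f ⟧ₙ (lookup ρ)  ≈⟨ normalise-correct f (lookup ρ) ⟩
    ⟦ f ⟧ (lookup ρ)             ∎

module Algebras (ℓ n : ℕ) (ℓ≤n : ℓ ≤ n) where

  open import Data.Nat using (_<?_)
  open Variety ℓ n ℓ≤n
  open import Level using (Level)
  open import Data.Fin using (Fin; #_)
  open import Data.Sum using (inj₁; inj₂; [_,_])
  open import Data.Product using (_,_)
  open import Data.Vec using (Vec; lookup)
  open import Relation.Binary using (Setoid)
  open import Relation.Binary.PropositionalEquality as ≡ using (_≡_)
  open import Relation.Nullary.Decidable using (True)
  open import Algebra.Bundles using (AbelianGroup)

  module _ {c e : Level} (A : UAlgebra c e) where
    open UAlgebra A
    open Setoid setoid

    ⟦⟧-cong : ∀ {V} (t : Term V) {ρ ρ′ : V → Carrier} → (∀ v → ρ v ≈ ρ′ v) → ⟦ A ⟧ t ρ ≈ ⟦ A ⟧ t ρ′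
    ⟦⟧-cong (var v)   ρ≈ = ρ≈ v
    ⟦⟧-cong (u i t)   ρ≈ = uᴬ-cong i (⟦⟧-cong t ρ≈)
    ⟦⟧-cong (r i s t) ρ≈ = rᴬ-cong i (⟦⟧-cong s ρ≈) (⟦⟧-cong t ρ≈)
    ⟦⟧-cong (m s t w) ρ≈ = mᴬ-cong (⟦⟧-cong s ρ≈) (⟦⟧-cong t ρ≈) (⟦⟧-cong w ρ≈)

    ⟦⟧-sound-Ax : ∀ {V} {s t : Term V} → Ax s t → ∀ ρ → ⟦ A ⟧ s ρ ≈ ⟦ A ⟧ t ρ
    ⟦⟧-sound-Ax (U1a _ _)             ρ = U1aᴬ _ _
    ⟦⟧-sound-Ax (U1b _ _)             ρ = U1bᴬ _ _
    ⟦⟧-sound-Ax (U2 _ _ _ _ _ _ _ _ _) ρ = U2ᴬ _ _ _ _ _ _ _ _ _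
    ⟦⟧-sound-Ax (U3 i _)              ρ = U3ᴬ i _
    ⟦⟧-sound-Ax (U4 i _ _ _ _ _ _)    ρ = U4ᴬ i _ _ _ _ _ _
    ⟦⟧-sound-Ax (U5 i _ _ _)          ρ = U5ᴬ i _ _ _
    ⟦⟧-sound-Ax (U6 i _ _)            ρ = U6ᴬ i _ _

    ⟦⟧-sound : ∀ {V} {s t : Term V} → s ≈U t → ∀ ρ → ⟦ A ⟧ s ρ ≈ ⟦ A ⟧ t ρ
    ⟦⟧-sound (ax a)         ρ = ⟦⟧-sound-Ax a ρ
    ⟦⟧-sound ≈refl          ρ = refl
    ⟦⟧-sound (≈sym s≈t)     ρ = sym (⟦⟧-sound s≈t ρ)
    ⟦⟧-sound (≈trans s≈t t≈w) ρ = trans (⟦⟧-sound s≈t ρ) (⟦⟧-sound t≈w ρ)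
    ⟦⟧-sound (u-cong i s≈t) ρ = uᴬ-cong i (⟦⟧-sound s≈t ρ)
    ⟦⟧-sound (r-cong i s≈t s′≈t′) ρ = rᴬ-cong i (⟦⟧-sound s≈t ρ) (⟦⟧-sound s′≈t′ ρ)
    ⟦⟧-sound (m-cong s≈t s′≈t′ s″≈t″) ρ =
      mᴬ-cong (⟦⟧-sound s≈t ρ) (⟦⟧-sound s′≈t′ ρ) (⟦⟧-sound s″≈t″ ρ)

    ⟦⟧-⟪⟫ : ∀ {V W} (s : Term V) (σ : V → Term W) ρ → ⟦ A ⟧ (s ⟪ σ ⟫) ρ ≡ ⟦ A ⟧ s (λ v → ⟦ A ⟧ (σ v) ρ)
    ⟦⟧-⟪⟫ (var v)   σ ρ = ≡.refl
    ⟦⟧-⟪⟫ (u i s)   σ ρ = ≡.cong (uᴬ i) (⟦⟧-⟪⟫ s σ ρ)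
    ⟦⟧-⟪⟫ (r i s t) σ ρ = ≡.cong₂ (rᴬ i) (⟦⟧-⟪⟫ s σ ρ) (⟦⟧-⟪⟫ t σ ρ)
    ⟦⟧-⟪⟫ (m s t w) σ ρ =
      ≡.cong₂ (λ a b → a b) (≡.cong₂ mᴬ (⟦⟧-⟪⟫ s σ ρ) (⟦⟧-⟪⟫ t σ ρ)) (⟦⟧-⟪⟫ w σ ρ)

    -- (U2), (U4) and (U5) say that every basic operation commutes with m.
    ⟦⟧-m : ∀ {V} (t : Term V) (ρ₁ ρ₂ ρ₃ : V → Carrier) →
           ⟦ A ⟧ t (λ v → mᴬ (ρ₁ v) (ρ₂ v) (ρ₃ v)) ≈ mᴬ (⟦ A ⟧ t ρ₁) (⟦ A ⟧ t ρ₂) (⟦ A ⟧ t ρ₃)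
    ⟦⟧-m (var v)   _  _  _  = refl
    ⟦⟧-m (u i t)   ρ₁ ρ₂ ρ₃ = trans (uᴬ-cong i (⟦⟧-m t ρ₁ ρ₂ ρ₃)) (sym (U5ᴬ i _ _ _))
    ⟦⟧-m (r i s t) ρ₁ ρ₂ ρ₃ =
      trans (rᴬ-cong i (⟦⟧-m s ρ₁ ρ₂ ρ₃) (⟦⟧-m t ρ₁ ρ₂ ρ₃)) (sym (U4ᴬ i _ _ _ _ _ _))
    ⟦⟧-m (m s t w) ρ₁ ρ₂ ρ₃ =
      trans (mᴬ-cong (⟦⟧-m s ρ₁ ρ₂ ρ₃) (⟦⟧-m t ρ₁ ρ₂ ρ₃) (⟦⟧-m w ρ₁ ρ₂ ρ₃)) (U2ᴬ _ _ _ _ _ _ _ _ _)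

    -- Write t(b, b′) as m(t(b, a′), t(a, a′), t(a, b′)) and use that t commutes with m.
    isAbelian : IsAbelianAlg A
    isAbelian p q t a b a′ b′ hyp = sym (begin
      ⟦ A ⟧ t [ b , b′ ]                                                   ≈⟨ ⟦⟧-cong t env ⟩
      ⟦ A ⟧ t (λ v → mᴬ ([ b , a′ ] v) ([ a , a′ ] v) ([ a , b′ ] v))      ≈⟨ ⟦⟧-m t [ b , a′ ] [ a , a′ ] [ a , b′ ] ⟩
      mᴬ (⟦ A ⟧ t [ b , a′ ]) (⟦ A ⟧ t [ a , a′ ]) (⟦ A ⟧ t [ a , b′ ])   ≈⟨ mᴬ-cong refl refl (sym hyp) ⟩
      mᴬ (⟦ A ⟧ t [ b , a′ ]) (⟦ A ⟧ t [ a , a′ ]) (⟦ A ⟧ t [ a , a′ ])   ≈⟨ U1aᴬ _ _ ⟩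
      ⟦ A ⟧ t [ b , a′ ]                                                   ∎)
      where
      open import Relation.Binary.Reasoning.Setoid setoid
      env : ∀ v → [ b , b′ ] v ≈ mᴬ ([ b , a′ ] v) ([ a , a′ ] v) ([ a , b′ ] v)
      env (inj₁ i) = sym (U1aᴬ _ _)
      env (inj₂ j) = sym (U1bᴬ _ _)

    m-idem : ∀ a → mᴬ a a a ≈ a
    m-idem a = U1aᴬ a a

    -- The identities below pad arguments with instances of (U1) and then apply the interchange law (U2).
    m-swap : ∀ a b d → mᴬ a b d ≈ mᴬ d b a
    m-swap a b d =
      trans (mᴬ-cong (sym (U1bᴬ a b)) (sym (m-idem b)) (sym (U1aᴬ d b)))
            (trans (U2ᴬ b b a b b b d b b) (mᴬ-cong (U1bᴬ d b) (m-idem b) (U1aᴬ a b)))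

    module Origin (o : Carrier) where

      _+ₒ_ : Carrier → Carrier → Carrier
      a +ₒ b = mᴬ a o b

      -ₒ_ : Carrier → Carrier
      -ₒ a = mᴬ o a o

      +ₒ-assoc : ∀ a b d → (a +ₒ b) +ₒ d ≈ a +ₒ (b +ₒ d)
      +ₒ-assoc a b d = trans (mᴬ-cong refl (sym (m-idem o)) (sym (U1bᴬ d o)))
                             (trans (U2ᴬ a o b o o o o o d) (mᴬ-cong (U1aᴬ a o) (m-idem o) refl))

      -ₒ-inverseʳ : ∀ a → a +ₒ (-ₒ a) ≈ o
      -ₒ-inverseʳ a = trans (mᴬ-cong (sym (U1aᴬ a o)) (sym (m-idem o)) refl)
                            (trans (U2ᴬ a o o o o o o a o)
                                   (trans (mᴬ-cong (U1aᴬ a o) (U1bᴬ a o) (m-idem o)) (U1bᴬ o a)))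

      abelianGroup : AbelianGroup c e
      abelianGroup = record
        { Carrier = Carrier ; _≈_ = _≈_ ; _∙_ = _+ₒ_ ; ε = o ; _⁻¹ = -ₒ_
        ; isAbelianGroup = record
          { isGroup = record
            { isMonoid = record
              { isSemigroup = record
                { isMagma = record { isEquivalence = isEquivalence ; ∙-cong = λ a≈ b≈ → mᴬ-cong a≈ refl b≈ }
                ; assoc = +ₒ-assoc }
              ; identity = (λ a → U1bᴬ a o) , (λ a → U1aᴬ a o) }
            ; inverse = (λ a → trans (m-swap _ o a) (-ₒ-inverseʳ a)) , -ₒ-inverseʳ
            ; ⁻¹-cong = λ a≈ → mᴬ-cong refl a≈ refl }
          ; comm = λ a b → m-swap a o b } }

      m≈-+ₒ : ∀ a b d → mᴬ a b d ≈ (a +ₒ (-ₒ b)) +ₒ d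
      m≈-+ₒ a b d = sym (begin
        (a +ₒ (-ₒ b)) +ₒ d        ≈⟨ +ₒ-assoc a (-ₒ b) d ⟩
        mᴬ a o (mᴬ (mᴬ o b o) o d) ≈⟨ mᴬ-cong refl refl -b+d ⟩
        mᴬ a o (mᴬ o b d)          ≈⟨ mᴬ-cong (sym (U1aᴬ a o)) (sym (m-idem o)) refl ⟩
        mᴬ (mᴬ a o o) (mᴬ o o o) (mᴬ o b d) ≈⟨ U2ᴬ a o o o o o o b d ⟩
        mᴬ (mᴬ a o o) (mᴬ o o b) (mᴬ o o d) ≈⟨ mᴬ-cong (U1aᴬ a o) (U1bᴬ b o) (U1bᴬ d o) ⟩
        mᴬ a b d                   ∎)
        where
        open import Relation.Binary.Reasoning.Setoid setoid
        -b+d : mᴬ (mᴬ o b o) o d ≈ mᴬ o b d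
        -b+d = trans (mᴬ-cong refl (sym (m-idem o)) (sym (U1bᴬ d o)))
                     (trans (U2ᴬ o b o o o o o o d) (mᴬ-cong (m-idem o) (U1aᴬ b o) (U1bᴬ d o)))

      -- Identities in m are decided by reading m(a, b, d) as a − b + d in abelianGroup.
      infixl 6 _⊕̂_
      infix 7 ⊖̂_
      data AffineExpr (k : ℕ) : Set where
        var  : Fin k → AffineExpr k
        ô    : AffineExpr k
        m̂    : AffineExpr k → AffineExpr k → AffineExpr k → AffineExpr k
        _⊕̂_ : AffineExpr k → AffineExpr k → AffineExpr k
        ⊖̂_  : AffineExpr k → AffineExpr k

      ‵_ : ∀ {k} (i : ℕ) {i<k : True (i <? k)} → AffineExpr k
      ‵_ i {i<k} = var ((# i) {m<n = i<k})

      ⟦_⟧ₐ : ∀ {k} → AffineExpr k → (Fin k → Carrier) → Carrier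
      ⟦ var i ⟧ₐ    ρ = ρ i
      ⟦ ô ⟧ₐ        ρ = o
      ⟦ m̂ a b d ⟧ₐ ρ = mᴬ (⟦ a ⟧ₐ ρ) (⟦ b ⟧ₐ ρ) (⟦ d ⟧ₐ ρ)
      ⟦ a ⊕̂ b ⟧ₐ   ρ = ⟦ a ⟧ₐ ρ +ₒ ⟦ b ⟧ₐ ρ
      ⟦ ⊖̂ a ⟧ₐ     ρ = -ₒ ⟦ a ⟧ₐ ρ

      module Solver = AbelianGroupSolver abelianGroup
      open Solver using (Expr; _⊞_; ⊟_; ε̂)

      toExpr : ∀ {k} → AffineExpr k → Expr k
      toExpr (var i)    = Expr.var i
      toExpr ô          = ε̂
      toExpr (m̂ a b d) = toExpr a ⊞ ⊟ toExpr b ⊞ toExpr d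
      toExpr (a ⊕̂ b)   = toExpr a ⊞ toExpr b
      toExpr (⊖̂ a)     = ⊟ toExpr a

      toExpr-correct : ∀ {k} (a : AffineExpr k) ρ → ⟦ a ⟧ₐ ρ ≈ Solver.⟦ toExpr a ⟧ ρ
      toExpr-correct (var i)    ρ = refl
      toExpr-correct ô          ρ = refl
      toExpr-correct (m̂ a b d) ρ = trans (m≈-+ₒ _ _ _)
        (mᴬ-cong (mᴬ-cong (toExpr-correct a ρ) refl (mᴬ-cong refl (toExpr-correct b ρ) refl)) refl (toExpr-correct d ρ))
      toExpr-correct (a ⊕̂ b)   ρ = mᴬ-cong (toExpr-correct a ρ) refl (toExpr-correct b ρ)
      toExpr-correct (⊖̂ a)     ρ = mᴬ-cong refl (toExpr-correct a ρ) refl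

      solve : ∀ {k} (a b : AffineExpr k) →
              True (Solver.balanced? (Solver.normalise (toExpr a)) (Solver.normalise (toExpr b))) →
              ∀ (ρ : Vec Carrier k) → ⟦ a ⟧ₐ (lookup ρ) ≈ ⟦ b ⟧ₐ (lookup ρ)
      solve a b bal ρ = trans (toExpr-correct a (lookup ρ))
        (trans (Solver.solve (toExpr a) (toExpr b) bal ρ) (sym (toExpr-correct b (lookup ρ))))

  isMalcev : IsMalcevVariety
  isMalcev = m (var (# 0)) (var (# 1)) (var (# 2)) ,ω λ A a b → UAlgebra.U1bᴬ A b a , UAlgebra.U1aᴬ A b a

module FreeAlgebra (ℓ n : ℕ) (ℓ≤n : ℓ ≤ n) where

  open Variety ℓ n ℓ≤n
  open Algebras ℓ n ℓ≤n using (⟦⟧-sound; ⟦⟧-cong; ⟦⟧-m; module Origin)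
  open import Level using (0ℓ)
  open import Data.Fin using (Fin)
  open import Data.Product using (Σ; _,_)
  open import Data.Unit using (⊤; tt)
  open import Data.Vec using (_∷_; [])
  open import Function using (const)
  import Relation.Binary.Reasoning.Setoid
  open import Relation.Binary.PropositionalEquality as ≡ using (_≡_)

  termAlgebra : Set → UAlgebra 0ℓ 0ℓ
  termAlgebra V = record
    { setoid = record { Carrier = Term V ; _≈_ = _≈U_
                      ; isEquivalence = record { refl = ≈refl ; sym = ≈sym ; trans = ≈trans } }
    ; uᴬ = u ; rᴬ = r ; mᴬ = m
    ; uᴬ-cong = u-cong ; rᴬ-cong = r-cong ; mᴬ-cong = m-cong
    ; U1aᴬ = λ a c → ax (U1a a c)
    ; U1bᴬ = λ a c → ax (U1b a c)
    ; U2ᴬ = λ x₁ x₂ x₃ y₁ y₂ y₃ z₁ z₂ z₃ → ax (U2 x₁ x₂ x₃ y₁ y₂ y₃ z₁ z₂ z₃)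
    ; U3ᴬ = λ i c → ax (U3 i c)
    ; U4ᴬ = λ i x₁ x₂ y₁ y₂ z₁ z₂ → ax (U4 i x₁ x₂ y₁ y₂ z₁ z₂)
    ; U5ᴬ = λ i a b c → ax (U5 i a b c)
    ; U6ᴬ = λ i a c → ax (U6 i a c)
    }

  ≡⇒≈U : ∀ {V} {s t : Term V} → s ≡ t → s ≈U t
  ≡⇒≈U ≡.refl = ≈refl

  ⟦⟧-termAlgebra : ∀ {V W} (s : Term V) (σ : V → Term W) → ⟦ termAlgebra W ⟧ s σ ≡ s ⟪ σ ⟫
  ⟦⟧-termAlgebra (var v)   σ = ≡.refl
  ⟦⟧-termAlgebra (u i s)   σ = ≡.cong (u i) (⟦⟧-termAlgebra s σ)
  ⟦⟧-termAlgebra (r i s t) σ = ≡.cong₂ (r i) (⟦⟧-termAlgebra s σ) (⟦⟧-termAlgebra t σ)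
  ⟦⟧-termAlgebra (m s t w) σ =
    ≡.cong₂ (λ a b → a b) (≡.cong₂ m (⟦⟧-termAlgebra s σ) (⟦⟧-termAlgebra t σ)) (⟦⟧-termAlgebra w σ)

  module _ {V W : Set} where

    private
      from⟦⟧ : ∀ (s t : Term V) {σ τ : V → Term W} →
               ⟦ termAlgebra W ⟧ s σ ≈U ⟦ termAlgebra W ⟧ t τ → s ⟪ σ ⟫ ≈U t ⟪ τ ⟫
      from⟦⟧ s t {σ} {τ} eq =
        ≈trans (≡⇒≈U (≡.sym (⟦⟧-termAlgebra s σ))) (≈trans eq (≡⇒≈U (⟦⟧-termAlgebra t τ)))

    ⟪⟫-resp-≈U : ∀ {s t : Term V} (σ : V → Term W) → s ≈U t → s ⟪ σ ⟫ ≈U t ⟪ σ ⟫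
    ⟪⟫-resp-≈U {s} {t} σ s≈t = from⟦⟧ s t (⟦⟧-sound (termAlgebra W) s≈t σ)

    ⟪⟫-cong : ∀ (s : Term V) {σ τ : V → Term W} → (∀ v → σ v ≈U τ v) → s ⟪ σ ⟫ ≈U s ⟪ τ ⟫
    ⟪⟫-cong s σ≈τ = from⟦⟧ s s (⟦⟧-cong (termAlgebra W) s σ≈τ)

    ⟪⟫-m : ∀ (s : Term V) (σ₁ σ₂ σ₃ : V → Term W) →
           s ⟪ (λ v → m (σ₁ v) (σ₂ v) (σ₃ v)) ⟫ ≈U m (s ⟪ σ₁ ⟫) (s ⟪ σ₂ ⟫) (s ⟪ σ₃ ⟫)
    ⟪⟫-m s σ₁ σ₂ σ₃ = ≈trans (≡⇒≈U (≡.sym (⟦⟧-termAlgebra s _))) (≈trans (⟦⟧-m (termAlgebra W) s σ₁ σ₂ σ₃)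
      (m-cong (≡⇒≈U (⟦⟧-termAlgebra s σ₁)) (≡⇒≈U (⟦⟧-termAlgebra s σ₂)) (≡⇒≈U (⟦⟧-termAlgebra s σ₃))))

    ⟪⟫-ext : ∀ (s : Term V) {σ τ : V → Term W} → (∀ v → σ v ≡ τ v) → s ⟪ σ ⟫ ≡ s ⟪ τ ⟫
    ⟪⟫-ext (var v)   σ≡τ = σ≡τ v
    ⟪⟫-ext (u i s)   σ≡τ = ≡.cong (u i) (⟪⟫-ext s σ≡τ)
    ⟪⟫-ext (r i s t) σ≡τ = ≡.cong₂ (r i) (⟪⟫-ext s σ≡τ) (⟪⟫-ext t σ≡τ)
    ⟪⟫-ext (m s t w) σ≡τ = ≡.cong₂ (λ a b → a b) (≡.cong₂ m (⟪⟫-ext s σ≡τ) (⟪⟫-ext t σ≡τ)) (⟪⟫-ext w σ≡τ)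

  ⟪⟫-⟪⟫ : ∀ {V W Y} (s : Term V) (σ : V → Term W) (τ : W → Term Y) →
          s ⟪ σ ⟫ ⟪ τ ⟫ ≡ s ⟪ (λ v → σ v ⟪ τ ⟫) ⟫
  ⟪⟫-⟪⟫ (var v)   σ τ = ≡.refl
  ⟪⟫-⟪⟫ (u i s)   σ τ = ≡.cong (u i) (⟪⟫-⟪⟫ s σ τ)
  ⟪⟫-⟪⟫ (r i s t) σ τ = ≡.cong₂ (r i) (⟪⟫-⟪⟫ s σ τ) (⟪⟫-⟪⟫ t σ τ)
  ⟪⟫-⟪⟫ (m s t w) σ τ = ≡.cong₂ (λ a b → a b) (≡.cong₂ m (⟪⟫-⟪⟫ s σ τ) (⟪⟫-⟪⟫ t σ τ)) (⟪⟫-⟪⟫ w σ τ)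

  ⟪⟫-var : ∀ {V} (s : Term V) {σ : V → Term V} → (∀ v → σ v ≡ var v) → s ⟪ σ ⟫ ≡ s
  ⟪⟫-var (var v)   σ≡var = σ≡var v
  ⟪⟫-var (u i s)   σ≡var = ≡.cong (u i) (⟪⟫-var s σ≡var)
  ⟪⟫-var (r i s t) σ≡var = ≡.cong₂ (r i) (⟪⟫-var s σ≡var) (⟪⟫-var t σ≡var)
  ⟪⟫-var (m s t w) σ≡var = ≡.cong₂ (λ a b → a b) (≡.cong₂ m (⟪⟫-var s σ≡var) (⟪⟫-var t σ≡var)) (⟪⟫-var w σ≡var)

  open Origin (termAlgebra XZ) Z public
    using (‵_; ô; m̂; _⊕̂_; ⊖̂_; solve)
  module ≈U-Reasoning = Relation.Binary.Reasoning.Setoid (UAlgebra.setoid (termAlgebra XZ))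

  m-idem : ∀ (a : F) → m a a a ≈U a
  m-idem a = ax (U1a a a)

  ⊖-inverseʳ : ∀ a → a ⊕ (⊖ a) ≈U Z
  ⊖-inverseʳ = Origin.-ₒ-inverseʳ (termAlgebra XZ) Z

  ⊕-assoc : ∀ a b c → (a ⊕ b) ⊕ c ≈U a ⊕ (b ⊕ c)
  ⊕-assoc = Origin.+ₒ-assoc (termAlgebra XZ) Z

  ⟨_,_⟩ : ∀ {V} → Term V → Term V → XZ → Term V
  ⟨ p , q ⟩ vx = p
  ⟨ p , q ⟩ vz = q

  ⊙-⟨⟩ : ∀ s t → s ⊙ t ≡ s ⟪ ⟨ t , Z ⟩ ⟫
  ⊙-⟨⟩ s t = ⟪⟫-ext s λ { vx → ≡.refl ; vz → ≡.refl }

  atZ : F → F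
  atZ s = s ⟪ const Z ⟫

  atZ-idem : ∀ s → atZ (atZ s) ≡ atZ s
  atZ-idem s = ⟪⟫-⟪⟫ s (const Z) (const Z)

  _−_ : F → F → F
  s − t = m s t Z

  InR-X : InR X
  InR-X = ≈refl

  InR-Z : InR Z
  InR-Z = ≈refl

  InR-m : ∀ {s t w} → InR s → InR t → InR w → InR (m s t w)
  InR-m s∈R t∈R w∈R = ≈trans (m-cong s∈R t∈R w∈R) (m-idem Z)

  InR-⊕ : ∀ {s t} → InR s → InR t → InR (s ⊕ t)
  InR-⊕ {s} {t} s∈R t∈R = InR-m {s} {Z} {t} s∈R InR-Z t∈R

  InR-⊖ : ∀ {s} → InR s → InR (⊖ s)
  InR-⊖ {s} s∈R = InR-m {Z} {s} {Z} InR-Z s∈R InR-Z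

  InR-⊙ : ∀ s t → InR s → InR t → InR (s ⊙ t)
  InR-⊙ s t s∈R t∈R =
    ≈trans (≡⇒≈U (⟪⟫-⟪⟫ s _ (const Z))) (≈trans (⟪⟫-cong s λ { vx → t∈R ; vz → ≈refl }) s∈R)

  InR-resp : ∀ {s t} → s ≈U t → InR s → InR t
  InR-resp s≈t s∈R = ≈trans (⟪⟫-resp-≈U (const Z) (≈sym s≈t)) s∈R

  InM-atZ : ∀ s → InM (atZ s)
  InM-atZ s = s ⟪ const (var tt) ⟫ , ≡⇒≈U (≡.sym (⟪⟫-⟪⟫ s (const (var tt)) (const Z)))

  InM⇒≈atZ : ∀ {t} → InM t → t ≈U atZ t
  InM⇒≈atZ {t} (s , t≈s) =
    ≈trans t≈s (≈trans (≡⇒≈U (≡.sym (⟪⟫-⟪⟫ s (const Z) (const Z)))) (⟪⟫-resp-≈U (const Z) (≈sym t≈s)))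

  InM-resp : ∀ {s t} → s ≈U t → InM s → InM t
  InM-resp s≈t (w , s≈w) = w , ≈trans (≈sym s≈t) s≈w

  InM-Z : InM Z
  InM-Z = var tt , ≈refl

  InM-m : ∀ {s t w} → InM s → InM t → InM w → InM (m s t w)
  InM-m (a , s≈a) (b , t≈b) (c , w≈c) = m a b c , m-cong s≈a t≈b w≈c

  InM-⊕ : ∀ {s t} → InM s → InM t → InM (s ⊕ t)
  InM-⊕ s∈M t∈M = InM-m s∈M InM-Z t∈M

  InM-⊖ : ∀ {s} → InM s → InM (⊖ s)
  InM-⊖ s∈M = InM-m InM-Z s∈M InM-Z

  InM-⊙ : ∀ a {v} → InM v → InM (a ⊙ v)
  InM-⊙ a {v} (b , v≈b) = a ⟪ ⟨ b , var tt ⟩ ⟫ , (begin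
    a ⊙ v                                   ≡⟨ ⊙-⟨⟩ a v ⟩
    a ⟪ ⟨ v , Z ⟩ ⟫                         ≈⟨ ⟪⟫-cong a (λ { vx → v≈b ; vz → ≈refl }) ⟩
    a ⟪ ⟨ b ⟪ const Z ⟫ , Z ⟩ ⟫            ≡⟨ ⟪⟫-ext a (λ { vx → ≡.refl ; vz → ≡.refl }) ⟩
    a ⟪ (λ v → ⟨ b , var tt ⟩ v ⟪ const Z ⟫) ⟫ ≡⟨ ⟪⟫-⟪⟫ a ⟨ b , var tt ⟩ (const Z) ⟨
    a ⟪ ⟨ b , var tt ⟩ ⟫ ⟪ const Z ⟫       ∎)
    where open ≈U-Reasoning

  InR∧InM⇒≈Z : ∀ {t} → InR t → InM t → t ≈U Z
  InR∧InM⇒≈Z t∈R t∈M = ≈trans (InM⇒≈atZ t∈M) t∈R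

  ⊙-congʳ : ∀ a {w w′} → w ≈U w′ → a ⊙ w ≈U a ⊙ w′
  ⊙-congʳ a {w} {w′} w≈w′ =
    ≈trans (≡⇒≈U (⊙-⟨⟩ a w))
           (≈trans (⟪⟫-cong a (λ { vx → w≈w′ ; vz → ≈refl })) (≡⇒≈U (≡.sym (⊙-⟨⟩ a w′))))

  ⊙-assoc : ∀ a b c → (a ⊙ b) ⊙ c ≈U a ⊙ (b ⊙ c)
  ⊙-assoc a b c = ≡⇒≈U (begin
    (a ⊙ b) ⊙ c                                 ≡⟨ ≡.cong (_⊙ c) (⊙-⟨⟩ a b) ⟩
    (a ⟪ ⟨ b , Z ⟩ ⟫) ⊙ c                       ≡⟨ ⊙-⟨⟩ (a ⟪ ⟨ b , Z ⟩ ⟫) c ⟩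
    a ⟪ ⟨ b , Z ⟩ ⟫ ⟪ ⟨ c , Z ⟩ ⟫               ≡⟨ ⟪⟫-⟪⟫ a ⟨ b , Z ⟩ ⟨ c , Z ⟩ ⟩
    a ⟪ (λ v → ⟨ b , Z ⟩ v ⟪ ⟨ c , Z ⟩ ⟫) ⟫     ≡⟨ ⟪⟫-ext a (λ { vx → ≡.sym (⊙-⟨⟩ b c) ; vz → ≡.refl }) ⟩
    a ⟪ ⟨ b ⊙ c , Z ⟩ ⟫                         ≡⟨ ⊙-⟨⟩ a (b ⊙ c) ⟨
    a ⊙ (b ⊙ c)                                 ∎)
    where open ≡.≡-Reasoning

  ⊙-zeroʳ : ∀ a → InR a → a ⊙ Z ≈U Z
  ⊙-zeroʳ a a∈R = ≈trans (≡⇒≈U (≡.trans (⊙-⟨⟩ a Z) (⟪⟫-ext a λ { vx → ≡.refl ; vz → ≡.refl }))) a∈R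

  ⊙-m : ∀ a x y w → InR a → a ⊙ m x y w ≈U m (a ⊙ x) (a ⊙ y) (a ⊙ w)
  ⊙-m a x y w a∈R = begin
    a ⊙ m x y w                ≡⟨ ⊙-⟨⟩ a (m x y w) ⟩
    a ⟪ ⟨ m x y w , Z ⟩ ⟫      ≈⟨ ⟪⟫-cong a (λ { vx → ≈refl ; vz → ≈sym (m-idem Z) }) ⟩
    a ⟪ (λ v → m (⟨ x , Z ⟩ v) (⟨ y , Z ⟩ v) (⟨ w , Z ⟩ v)) ⟫ ≈⟨ ⟪⟫-m a ⟨ x , Z ⟩ ⟨ y , Z ⟩ ⟨ w , Z ⟩ ⟩
    m (a ⟪ ⟨ x , Z ⟩ ⟫) (a ⟪ ⟨ y , Z ⟩ ⟫) (a ⟪ ⟨ w , Z ⟩ ⟫)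
      ≡⟨ ≡.cong₂ (λ p q → m p q (a ⟪ ⟨ w , Z ⟩ ⟫)) (⊙-⟨⟩ a x) (⊙-⟨⟩ a y) ⟨
    m (a ⊙ x) (a ⊙ y) (a ⟪ ⟨ w , Z ⟩ ⟫) ≡⟨ ≡.cong (m (a ⊙ x) (a ⊙ y)) (⊙-⟨⟩ a w) ⟨
    m (a ⊙ x) (a ⊙ y) (a ⊙ w)  ∎
    where open ≈U-Reasoning

  ⊙-distribˡ : ∀ a x y → InR a → a ⊙ (x ⊕ y) ≈U (a ⊙ x) ⊕ (a ⊙ y)
  ⊙-distribˡ a x y a∈R = ≈trans (⊙-m a x Z y a∈R) (m-cong ≈refl (⊙-zeroʳ a a∈R) ≈refl)

  ⊙-−ʳ : ∀ a x y → InR a → a ⊙ (x − y) ≈U (a ⊙ x) − (a ⊙ y)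
  ⊙-−ʳ a x y a∈R = ≈trans (⊙-m a x y Z a∈R) (m-cong ≈refl ≈refl (⊙-zeroʳ a a∈R))

  rgen : Fin n → F
  rgen i = r i X Z

  InR-rgen : ∀ i → InR (rgen i)
  InR-rgen i = ax (U3 i Z)

  r-m : ∀ i a b c → r i (m a b c) Z ≈U m (r i a Z) (r i b Z) (r i c Z)
  r-m i a b c = ≈trans (r-cong i ≈refl (≈sym (m-idem Z))) (≈sym (ax (U4 i a Z b Z c Z)))

  r-− : ∀ i a b → r i (a − b) Z ≈U r i a Z − r i b Z
  r-− i a b = ≈trans (r-m i a b Z) (m-cong ≈refl ≈refl (ax (U3 i Z)))

  r-affine : ∀ i a b → r i a b ≈U m (r i a Z) (r i b Z) b
  r-affine i a b = ≈trans (r-cong i (≈sym (ax (U1a a b))) (≈sym (ax (U1b b Z))))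
                          (≈trans (≈sym (ax (U4 i a Z b Z b b))) (m-cong ≈refl ≈refl (ax (U3 i b))))

  u-affine : ∀ i a → u i a ≈U r (ι i) a Z ⊕ u i Z
  u-affine i a = ≈trans (≈sym (solve (m̂ (‵ 0) (‵ 1) ô ⊕̂ ‵ 1) (‵ 0) tt (u i a ∷ u i Z ∷ [])))
                        (m-cong (ax (U6 i a Z)) ≈refl ≈refl)

  u-difference : ∀ i s t → u i s − u i t ≈U r (ι i) (s − t) Z
  u-difference i s t = begin
    u i s − u i t
      ≈⟨ m-cong (u-affine i s) (u-affine i t) ≈refl ⟩
    (r (ι i) s Z ⊕ u i Z) − (r (ι i) t Z ⊕ u i Z)
      ≈⟨ solve (m̂ (‵ 0 ⊕̂ ‵ 2) (‵ 1 ⊕̂ ‵ 2) ô) (m̂ (‵ 0) (‵ 1) ô) tt (r (ι i) s Z ∷ r (ι i) t Z ∷ u i Z ∷ []) ⟩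
    r (ι i) s Z − r (ι i) t Z
      ≈⟨ r-− (ι i) s t ⟨
    r (ι i) (s − t) Z
      ∎
    where open ≈U-Reasoning

  r-difference : ∀ i s t s′ t′ → r i s t − r i s′ t′ ≈U r i (s − s′) Z ⊕ ((t − t′) ⊕ (⊖ r i (t − t′) Z))
  r-difference i s t s′ t′ = begin
    r i s t − r i s′ t′
      ≈⟨ m-cong (r-affine i s t) (r-affine i s′ t′) ≈refl ⟩
    m (r i s Z) (r i t Z) t − m (r i s′ Z) (r i t′ Z) t′
      ≈⟨ solve (m̂ (m̂ (‵ 0) (‵ 2) (‵ 3)) (m̂ (‵ 1) (‵ 4) (‵ 5)) ô)
               (m̂ (‵ 0) (‵ 1) ô ⊕̂ (m̂ (‵ 3) (‵ 5) ô ⊕̂ ⊖̂ m̂ (‵ 2) (‵ 4) ô)) tt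
               (r i s Z ∷ r i s′ Z ∷ r i t Z ∷ t ∷ r i t′ Z ∷ t′ ∷ []) ⟩
    (r i s Z − r i s′ Z) ⊕ ((t − t′) ⊕ (⊖ (r i t Z − r i t′ Z)))
      ≈⟨ m-cong (r-− i s s′) ≈refl (m-cong ≈refl ≈refl (m-cong ≈refl (r-− i t t′) ≈refl)) ⟨
    r i (s − s′) Z ⊕ ((t − t′) ⊕ (⊖ r i (t − t′) Z))
      ∎
    where open ≈U-Reasoning

  m-difference : ∀ s t w s′ t′ w′ → m s t w − m s′ t′ w′ ≈U ((s − s′) ⊕ (⊖ (t − t′))) ⊕ (w − w′)
  m-difference s t w s′ t′ w′ =
    solve (m̂ (m̂ (‵ 0) (‵ 1) (‵ 2)) (m̂ (‵ 3) (‵ 4) (‵ 5)) ô)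
          ((m̂ (‵ 0) (‵ 3) ô ⊕̂ ⊖̂ m̂ (‵ 1) (‵ 4) ô) ⊕̂ m̂ (‵ 2) (‵ 5) ô) tt
          (s ∷ t ∷ w ∷ s′ ∷ t′ ∷ w′ ∷ [])

  -- The R_𝓤-component of t in F_𝓤(x, z) = R_𝓤 ⊕ M_𝓤; its M_𝓤-component is atZ t.
  ringPart : F → F
  ringPart t = t − atZ t

  InR-ringPart : ∀ t → InR (ringPart t)
  InR-ringPart t = ≈trans (m-cong ≈refl (≡⇒≈U (atZ-idem t)) ≈refl) (ax (U1b Z (atZ t)))

  InR⇒≈ringPart : ∀ {t} → InR t → t ≈U ringPart t
  InR⇒≈ringPart {t} t∈R = ≈trans (≈sym (ax (U1a t Z))) (m-cong ≈refl (≈sym t∈R) ≈refl)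

  ringPart⊕atZ : ∀ t → t ≈U ringPart t ⊕ atZ t
  ringPart⊕atZ t = ≈sym (solve (m̂ (‵ 0) (‵ 1) ô ⊕̂ ‵ 1) (‵ 0) tt (t ∷ atZ t ∷ []))

  InR⇒⟪⟨⟩⟫ : ∀ a p q → InR a → a ⟪ ⟨ p , q ⟩ ⟫ ≈U (a ⊙ (p − q)) ⊕ q
  InR⇒⟪⟨⟩⟫ a p q a∈R = begin
    a ⟪ ⟨ p , q ⟩ ⟫
      ≈⟨ ⟪⟫-cong a (λ { vx → ≈sym (solve (m̂ (‵ 0) (‵ 1) ô ⊕̂ ‵ 1) (‵ 0) tt (p ∷ q ∷ []))
                      ; vz → ≈sym (ax (U1b q Z)) }) ⟩
    a ⟪ (λ v → m (⟨ p − q , Z ⟩ v) (const Z v) (const q v)) ⟫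
      ≈⟨ ⟪⟫-m a ⟨ p − q , Z ⟩ (const Z) (const q) ⟩
    m (a ⟪ ⟨ p − q , Z ⟩ ⟫) (atZ a) (a ⟪ const q ⟫)
      ≈⟨ m-cong (≡⇒≈U (≡.sym (⊙-⟨⟩ a (p − q)))) a∈R a⟪q⟫≈q ⟩
    (a ⊙ (p − q)) ⊕ q
      ∎
    where
    open ≈U-Reasoning
    a⟪q⟫≈q : a ⟪ const q ⟫ ≈U q
    a⟪q⟫≈q = ≈trans (≡⇒≈U (≡.sym (⟪⟫-⟪⟫ a (const Z) (const q)))) (⟪⟫-resp-≈U (const q) a∈R)

  defect : F → F
  defect f = (atX f ⊕ (⊖ f)) ⊕ (⊖ X)

  defect-resp : ∀ {s t} → s ≈U t → defect s ≈U defect t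
  defect-resp s≈t = m-cong (m-cong (⟪⟫-resp-≈U _ s≈t) ≈refl (m-cong ≈refl s≈t ≈refl)) ≈refl ≈refl

  defect-Z : defect Z ≈U Z
  defect-Z = solve ((‵ 0 ⊕̂ ⊖̂ ô) ⊕̂ ⊖̂ ‵ 0) ô tt (X ∷ [])

  defect-⊕ : ∀ s t → defect (s ⊕ t) ≈U defect s ⊕ defect t
  defect-⊕ s t =
    solve ((m̂ (‵ 0) (‵ 4) (‵ 1) ⊕̂ ⊖̂ (‵ 2 ⊕̂ ‵ 3)) ⊕̂ ⊖̂ ‵ 4)
          (((‵ 0 ⊕̂ ⊖̂ ‵ 2) ⊕̂ ⊖̂ ‵ 4) ⊕̂ ((‵ 1 ⊕̂ ⊖̂ ‵ 3) ⊕̂ ⊖̂ ‵ 4)) tt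
          (atX s ∷ atX t ∷ s ∷ t ∷ X ∷ [])

  InR-defect : ∀ f → InR (defect f)
  InR-defect f = ≈trans (m-cong (m-cong (≡⇒≈U (⟪⟫-⟪⟫ f (const X) (const Z))) ≈refl ≈refl) ≈refl ≈refl)
                        (solve ((‵ 0 ⊕̂ ⊖̂ ‵ 0) ⊕̂ ⊖̂ ô) ô tt (atZ f ∷ []))

  defect-⊙ : ∀ a v → InR a → defect (a ⊙ v) ≈U a ⊙ defect v
  defect-⊙ a v a∈R = begin
    defect (a ⊙ v)
      ≈⟨ m-cong (m-cong atX[a⊙v] ≈refl ≈refl) ≈refl ≈refl ⟩
    (((a ⊙ (atX v − X)) ⊕ X) ⊕ (⊖ (a ⊙ v))) ⊕ (⊖ X)
      ≈⟨ solve (((‵ 0 ⊕̂ ‵ 1) ⊕̂ ⊖̂ ‵ 2) ⊕̂ ⊖̂ ‵ 1) (m̂ (‵ 0) (‵ 2) ô) tt (a ⊙ (atX v − X) ∷ X ∷ a ⊙ v ∷ []) ⟩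
    (a ⊙ (atX v − X)) − (a ⊙ v)
      ≈⟨ ⊙-−ʳ a (atX v − X) v a∈R ⟨
    a ⊙ ((atX v − X) − v)
      ≈⟨ ⊙-congʳ a (solve (m̂ (m̂ (‵ 0) (‵ 1) ô) (‵ 2) ô) ((‵ 0 ⊕̂ ⊖̂ ‵ 2) ⊕̂ ⊖̂ ‵ 1) tt (atX v ∷ X ∷ v ∷ [])) ⟩
    a ⊙ defect v
      ∎
    where
    open ≈U-Reasoning
    atX[a⊙v] : atX (a ⊙ v) ≈U (a ⊙ (atX v − X)) ⊕ X
    atX[a⊙v] = ≈trans (≡⇒≈U (≡.trans (≡.cong atX (⊙-⟨⟩ a v))
                        (≡.trans (⟪⟫-⟪⟫ a ⟨ v , Z ⟩ (const X)) (⟪⟫-ext a λ { vx → ≡.refl ; vz → ≡.refl }))))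
                      (InR⇒⟪⟨⟩⟫ a (atX v) X a∈R)

module FreeRing (ℓ n : ℕ) (ℓ≤n : ℓ ≤ n) where

  open Variety ℓ n ℓ≤n
  open Algebras ℓ n ℓ≤n using (⟦⟧-sound; ⟦⟧-cong; ⟦⟧-⟪⟫)
  open FreeAlgebra ℓ n ℓ≤n hiding (‵_; solve)
  open import Level using (Level)
  open import Data.Fin using (Fin)
  open import Data.Product using (_,_)
  open import Data.Unit using (tt)
  open import Data.Vec using (_∷_; [])
  open import Relation.Binary.PropositionalEquality as ≡ using (_≡_)
  open import Algebra.Bundles using (Ring)

  module _ {c e : Level} (S : Ring c e) (g : Fin n → Ring.Carrier S) where

    open Ring S
    open import Algebra.Properties.Ring S using (x[y-z]≈xy-xz; [y-z]x≈yx-zx; x+x≈x⇒x≈0; +-inverseʳ-unique)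
    open import Relation.Binary.Reasoning.Setoid setoid
    open AbelianGroupSolver +-abelianGroup using (‵_; ε̂; _⊞_; ⊟_; solve)

    mˢ : Carrier → Carrier → Carrier → Carrier
    mˢ a b d = (a - b) + d

    1-g[_]*_ : Fin n → Carrier → Carrier
    1-g[ i ]* a = (1# - g i) * a

    1-g*≈ : ∀ i a → 1-g[ i ]* a ≈ a - g i * a
    1-g*≈ i a = trans ([y-z]x≈yx-zx a 1# (g i)) (+-congʳ (*-identityˡ a))

    *-mˢ : ∀ k a b d → k * mˢ a b d ≈ mˢ (k * a) (k * b) (k * d)
    *-mˢ k a b d = trans (distribˡ k (a - b) d) (+-congʳ (x[y-z]≈xy-xz k a b))

    ringAlgebra : UAlgebra c e
    ringAlgebra = record
      { setoid = setoid
      ; uᴬ = λ i a → g (ι i) * a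
      ; rᴬ = λ i a b → g i * a + 1-g[ i ]* b
      ; mᴬ = mˢ
      ; uᴬ-cong = λ i a≈ → *-congˡ a≈
      ; rᴬ-cong = λ i a≈ b≈ → +-cong (*-congˡ a≈) (*-congˡ b≈)
      ; mᴬ-cong = λ a≈ b≈ d≈ → +-cong (+-cong a≈ (-‿cong b≈)) d≈
      ; U1aᴬ = λ a d → solve ((‵ 0 ⊞ ⊟ ‵ 1) ⊞ ‵ 1) (‵ 0) tt (a ∷ d ∷ [])
      ; U1bᴬ = λ a d → solve ((‵ 1 ⊞ ⊟ ‵ 1) ⊞ ‵ 0) (‵ 0) tt (a ∷ d ∷ [])
      ; U2ᴬ = λ x₁ x₂ x₃ y₁ y₂ y₃ z₁ z₂ z₃ →
          let M = λ a b d → (a ⊞ ⊟ b) ⊞ d in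
          solve (M (M (‵ 0) (‵ 1) (‵ 2)) (M (‵ 3) (‵ 4) (‵ 5)) (M (‵ 6) (‵ 7) (‵ 8)))
                (M (M (‵ 0) (‵ 3) (‵ 6)) (M (‵ 1) (‵ 4) (‵ 7)) (M (‵ 2) (‵ 5) (‵ 8))) tt
                (x₁ ∷ x₂ ∷ x₃ ∷ y₁ ∷ y₂ ∷ y₃ ∷ z₁ ∷ z₂ ∷ z₃ ∷ [])
      ; U3ᴬ = λ i d → begin
          g i * d + 1-g[ i ]* d   ≈⟨ +-congˡ (1-g*≈ i d) ⟩
          g i * d + (d - g i * d) ≈⟨ solve (‵ 0 ⊞ (‵ 1 ⊞ ⊟ ‵ 0)) (‵ 1) tt (g i * d ∷ d ∷ []) ⟩
          d                       ∎
      ; U4ᴬ = λ i x₁ x₂ y₁ y₂ z₁ z₂ → sym (begin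
          g i * mˢ x₁ y₁ z₁ + 1-g[ i ]* mˢ x₂ y₂ z₂
            ≈⟨ +-cong (*-mˢ _ _ _ _) (*-mˢ _ _ _ _) ⟩
          mˢ (g i * x₁) (g i * y₁) (g i * z₁) + mˢ (1-g[ i ]* x₂) (1-g[ i ]* y₂) (1-g[ i ]* z₂)
            ≈⟨ (let M = λ a b d → (a ⊞ ⊟ b) ⊞ d in
                solve (M (‵ 0) (‵ 1) (‵ 2) ⊞ M (‵ 3) (‵ 4) (‵ 5)) (M (‵ 0 ⊞ ‵ 3) (‵ 1 ⊞ ‵ 4) (‵ 2 ⊞ ‵ 5)) tt
                  (g i * x₁ ∷ g i * y₁ ∷ g i * z₁ ∷ 1-g[ i ]* x₂ ∷ 1-g[ i ]* y₂ ∷ 1-g[ i ]* z₂ ∷ [])) ⟩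
          mˢ (g i * x₁ + 1-g[ i ]* x₂) (g i * y₁ + 1-g[ i ]* y₂) (g i * z₁ + 1-g[ i ]* z₂) ∎)
      ; U5ᴬ = λ i a b d → sym (*-mˢ _ _ _ _)
      ; U6ᴬ = λ i a d → begin
          (g (ι i) * a - g (ι i) * d) + d   ≈⟨ solve ((‵ 0 ⊞ ⊟ ‵ 1) ⊞ ‵ 2) (‵ 0 ⊞ (‵ 2 ⊞ ⊟ ‵ 1)) tt
                                                    (g (ι i) * a ∷ g (ι i) * d ∷ d ∷ []) ⟩
          g (ι i) * a + (d - g (ι i) * d)   ≈⟨ +-congˡ (1-g*≈ (ι i) d) ⟨
          g (ι i) * a + 1-g[ ι i ]* d       ∎
      }

    ⟦_⟧ˢ : F → (XZ → Carrier) → Carrier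
    ⟦_⟧ˢ = ⟦ ringAlgebra ⟧

    ⟦⟧ˢ-*ʳ : ∀ s ρ k → ⟦ s ⟧ˢ (λ v → ρ v * k) ≈ ⟦ s ⟧ˢ ρ * k
    ⟦⟧ˢ-*ʳ (var v)   ρ k = refl
    ⟦⟧ˢ-*ʳ (u i s)   ρ k = trans (*-congˡ (⟦⟧ˢ-*ʳ s ρ k)) (sym (*-assoc _ _ _))
    ⟦⟧ˢ-*ʳ (r i s t) ρ k = begin
      g i * ⟦ s ⟧ˢ ρk + 1-g[ i ]* ⟦ t ⟧ˢ ρk             ≈⟨ +-cong (*-congˡ (⟦⟧ˢ-*ʳ s ρ k)) (*-congˡ (⟦⟧ˢ-*ʳ t ρ k)) ⟩
      g i * (⟦ s ⟧ˢ ρ * k) + 1-g[ i ]* (⟦ t ⟧ˢ ρ * k)   ≈⟨ +-cong (*-assoc _ _ _) (*-assoc _ _ _) ⟨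
      g i * ⟦ s ⟧ˢ ρ * k + 1-g[ i ]* ⟦ t ⟧ˢ ρ * k       ≈⟨ distribʳ k _ _ ⟨
      (g i * ⟦ s ⟧ˢ ρ + 1-g[ i ]* ⟦ t ⟧ˢ ρ) * k         ∎
      where ρk = λ v → ρ v * k
    ⟦⟧ˢ-*ʳ (m s t w) ρ k = begin
      mˢ (⟦ s ⟧ˢ ρk) (⟦ t ⟧ˢ ρk) (⟦ w ⟧ˢ ρk)
        ≈⟨ +-cong (+-cong (⟦⟧ˢ-*ʳ s ρ k) (-‿cong (⟦⟧ˢ-*ʳ t ρ k))) (⟦⟧ˢ-*ʳ w ρ k) ⟩
      mˢ (⟦ s ⟧ˢ ρ * k) (⟦ t ⟧ˢ ρ * k) (⟦ w ⟧ˢ ρ * k)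
        ≈⟨ +-congʳ ([y-z]x≈yx-zx k _ _) ⟨
      (⟦ s ⟧ˢ ρ - ⟦ t ⟧ˢ ρ) * k + ⟦ w ⟧ˢ ρ * k
        ≈⟨ distribʳ k _ _ ⟨
      mˢ (⟦ s ⟧ˢ ρ) (⟦ t ⟧ˢ ρ) (⟦ w ⟧ˢ ρ) * k
        ∎
      where ρk = λ v → ρ v * k

    x↦1,z↦0 : XZ → Carrier
    x↦1,z↦0 vx = 1#
    x↦1,z↦0 vz = 0#

    extension : RMap S g
    extension t _ = ⟦ t ⟧ˢ x↦1,z↦0

    ⟦⊙⟧ˢ : ∀ s t → ⟦ s ⊙ t ⟧ˢ x↦1,z↦0 ≈ ⟦ s ⟧ˢ x↦1,z↦0 * ⟦ t ⟧ˢ x↦1,z↦0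
    ⟦⊙⟧ˢ s t = begin
      ⟦ s ⊙ t ⟧ˢ x↦1,z↦0                              ≡⟨ ≡.cong (λ w → ⟦ w ⟧ˢ x↦1,z↦0) (⊙-⟨⟩ s t) ⟩
      ⟦ s ⟪ ⟨ t , Z ⟩ ⟫ ⟧ˢ x↦1,z↦0                    ≡⟨ ⟦⟧-⟪⟫ ringAlgebra s ⟨ t , Z ⟩ x↦1,z↦0 ⟩
      ⟦ s ⟧ˢ (λ v → ⟦ ⟨ t , Z ⟩ v ⟧ˢ x↦1,z↦0)        ≈⟨ ⟦⟧-cong ringAlgebra s (λ { vx → sym (*-identityˡ _) ; vz → sym (zeroˡ _) }) ⟩
      ⟦ s ⟧ˢ (λ v → x↦1,z↦0 v * ⟦ t ⟧ˢ x↦1,z↦0)      ≈⟨ ⟦⟧ˢ-*ʳ s x↦1,z↦0 _ ⟩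
      ⟦ s ⟧ˢ x↦1,z↦0 * ⟦ t ⟧ˢ x↦1,z↦0                 ∎

    extension-isHom : IsExtendingHom S g extension
    extension-isHom = record
      { well-defined = λ s t _ _ s≈t → ⟦⟧-sound ringAlgebra s≈t x↦1,z↦0
      ; hom-+ = λ s t _ _ _ → solve ((‵ 0 ⊞ ⊟ ε̂) ⊞ ‵ 1) (‵ 0 ⊞ ‵ 1) tt (⟦ s ⟧ˢ x↦1,z↦0 ∷ ⟦ t ⟧ˢ x↦1,z↦0 ∷ [])
      ; hom-* = λ s t _ _ _ → ⟦⊙⟧ˢ s t
      ; hom-1 = λ _ → refl
      ; extends = λ i _ → trans (+-cong (*-identityʳ (g i)) (zeroʳ _)) (+-identityʳ (g i))
      }

    module _ {ψ : RMap S g} (ψ-isHom : IsExtendingHom S g ψ) where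

      open IsExtendingHom ψ-isHom

      ψ-Z : ∀ p → ψ Z p ≈ 0#
      ψ-Z p = x+x≈x⇒x≈0 _ (trans (sym (hom-+ Z Z p p (InR-⊕ {Z} {Z} p p))) (well-defined _ _ _ _ (ax (U1b Z Z))))

      ψ-⊖ : ∀ s p q → ψ (⊖ s) q ≈ - ψ s p
      ψ-⊖ s p q = +-inverseʳ-unique _ _
        (trans (sym (hom-+ s (⊖ s) p q (InR-⊕ {s} {⊖ s} p q))) (trans (well-defined _ Z _ InR-Z (⊖-inverseʳ s)) (ψ-Z InR-Z)))

      ψ-rgen⊙ : ∀ i s p q → ψ (rgen i ⊙ s) q ≈ g i * ψ s p
      ψ-rgen⊙ i s p q = trans (hom-* _ _ (InR-rgen i) p q) (*-congʳ (extends i _))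

      InR-rgen⊙ringPart : ∀ i s → InR (rgen i ⊙ ringPart s)
      InR-rgen⊙ringPart i s = InR-⊙ (rgen i) (ringPart s) (InR-rgen i) (InR-ringPart s)

      ψ-ringPart : ∀ s (p : InR (ringPart s)) → ψ (ringPart s) p ≈ ⟦ s ⟧ˢ x↦1,z↦0
      ψ-ringPart (var vx) p = trans (well-defined _ _ p InR-X (ax (U1a X Z))) (hom-1 InR-X)
      ψ-ringPart (var vz) p = trans (well-defined _ _ p InR-Z (m-idem Z)) (ψ-Z InR-Z)
      ψ-ringPart (u i s) p = begin
        ψ (ringPart (u i s)) p                       ≈⟨ well-defined _ _ p q (u-difference i s (atZ s)) ⟩
        ψ (rgen (ι i) ⊙ ringPart s) q                ≈⟨ ψ-rgen⊙ (ι i) (ringPart s) (InR-ringPart s) q ⟩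
        g (ι i) * ψ (ringPart s) (InR-ringPart s)    ≈⟨ *-congˡ (ψ-ringPart s _) ⟩
        g (ι i) * ⟦ s ⟧ˢ x↦1,z↦0                     ∎
        where q = InR-rgen⊙ringPart (ι i) s
      ψ-ringPart (r i s t) p = begin
        ψ (ringPart (r i s t)) p
          ≈⟨ well-defined _ _ p q (r-difference i s t (atZ s) (atZ t)) ⟩
        ψ (A ⊕ (B ⊕ (⊖ C))) q
          ≈⟨ hom-+ _ _ pA (InR-⊕ {B} {⊖ C} pB (InR-⊖ {C} pC)) q ⟩
        ψ A pA + ψ (B ⊕ (⊖ C)) _
          ≈⟨ +-congˡ (hom-+ _ _ pB (InR-⊖ {C} pC) _) ⟩
        ψ A pA + (ψ B pB + ψ (⊖ C) _)
          ≈⟨ +-cong (ψ-rgen⊙ i _ ps pA) (+-congˡ (ψ-⊖ C pC _)) ⟩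
        g i * ψ (ringPart s) ps + (ψ B pB - ψ C pC)
          ≈⟨ +-congˡ (+-congˡ (-‿cong (ψ-rgen⊙ i _ pB pC))) ⟩
        g i * ψ (ringPart s) ps + (ψ B pB - g i * ψ B pB)
          ≈⟨ +-congˡ (1-g*≈ i _) ⟨
        g i * ψ (ringPart s) ps + 1-g[ i ]* ψ B pB
          ≈⟨ +-cong (*-congˡ (ψ-ringPart s ps)) (*-congˡ (ψ-ringPart t pB)) ⟩
        g i * ⟦ s ⟧ˢ x↦1,z↦0 + 1-g[ i ]* ⟦ t ⟧ˢ x↦1,z↦0
          ∎
        where
        A = rgen i ⊙ ringPart s ; B = ringPart t ; C = rgen i ⊙ ringPart t
        ps = InR-ringPart s ; pA = InR-rgen⊙ringPart i s ; pB = InR-ringPart t ; pC = InR-rgen⊙ringPart i t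
        q = InR-⊕ {A} {B ⊕ (⊖ C)} pA (InR-⊕ {B} {⊖ C} pB (InR-⊖ {C} pC))
      ψ-ringPart (m s t w) p = begin
        ψ (ringPart (m s t w)) p
          ≈⟨ well-defined _ _ p q (m-difference s t w (atZ s) (atZ t) (atZ w)) ⟩
        ψ ((ringPart s ⊕ (⊖ ringPart t)) ⊕ ringPart w) q
          ≈⟨ hom-+ _ _ (InR-⊕ {ringPart s} {⊖ ringPart t} ps (InR-⊖ {ringPart t} pt)) pw q ⟩
        ψ (ringPart s ⊕ (⊖ ringPart t)) _ + ψ (ringPart w) pw
          ≈⟨ +-congʳ (hom-+ _ _ ps (InR-⊖ {ringPart t} pt) _) ⟩
        (ψ (ringPart s) ps + ψ (⊖ ringPart t) _) + ψ (ringPart w) pw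
          ≈⟨ +-cong (+-cong (ψ-ringPart s ps) (trans (ψ-⊖ _ pt _) (-‿cong (ψ-ringPart t pt)))) (ψ-ringPart w pw) ⟩
        mˢ (⟦ s ⟧ˢ x↦1,z↦0) (⟦ t ⟧ˢ x↦1,z↦0) (⟦ w ⟧ˢ x↦1,z↦0)
          ∎
        where
        ps = InR-ringPart s ; pt = InR-ringPart t ; pw = InR-ringPart w
        q = InR-⊕ {ringPart s ⊕ (⊖ ringPart t)} {ringPart w}
                  (InR-⊕ {ringPart s} {⊖ ringPart t} ps (InR-⊖ {ringPart t} pt)) pw

      extension-unique : ∀ t (p : InR t) → ψ t p ≈ extension t p
      extension-unique t p = trans (well-defined _ _ p (InR-ringPart t) (InR⇒≈ringPart p)) (ψ-ringPart t _)

  isFreeRing : RIsFreeRing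
  isFreeRing S g = extension S g , extension-isHom S g , λ ψ ψ-isHom → extension-unique S g ψ-isHom

module FreeModule (ℓ n : ℕ) (ℓ≤n : ℓ ≤ n) where

  open Variety ℓ n ℓ≤n
  open Algebras ℓ n ℓ≤n using (⟦⟧-sound; ⟦⟧-⟪⟫)
  open FreeAlgebra ℓ n ℓ≤n
  open import Level using (0ℓ)
  open import Data.Nat using (zero; suc)
  open import Data.Bool using (Bool; true; false)
  open import Data.Fin using (Fin; zero; suc)
  open import Data.Fin.Properties using (_≟_)
  open import Data.List using (map; tabulate)
  open import Data.List.Properties using (map-tabulate)
  open import Data.Product using (Σ; _×_; _,_)
  open import Data.Unit using (⊤; tt)
  open import Data.Vec using (_∷_; [])
  open import Data.Vec.Functional using (foldr; head; tail)
  open import Function using (const; id; _∘_)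
  open import Relation.Binary.PropositionalEquality as ≡ using (_≡_)
  open import Relation.Nullary using (does)

  ∑ : ∀ {k} → (Fin k → F) → F
  ∑ = foldr _⊕_ Z

  linComb≡∑ : ∀ a → linComb a ≡ ∑ (λ i → a i ⊙ u i Z)
  linComb≡∑ a = ≡.trans (≡.cong sumF (map-tabulate id (λ i → a i ⊙ u i Z))) (sumF-tabulate {ℓ} _)
    where
    sumF-tabulate : ∀ {k} (f : Fin k → F) → sumF (tabulate f) ≡ ∑ f
    sumF-tabulate {zero}  f = ≡.refl
    sumF-tabulate {suc k} f = ≡.cong (f zero ⊕_) (sumF-tabulate (tail f))

  ∑-cong : ∀ {k} {a b : Fin k → F} → (∀ i → a i ≈U b i) → ∑ a ≈U ∑ b
  ∑-cong {zero}  a≈b = ≈refl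
  ∑-cong {suc k} a≈b = m-cong (a≈b zero) ≈refl (∑-cong (a≈b ∘ suc))

  ∑-zero : ∀ {k} → ∑ {k} (const Z) ≈U Z
  ∑-zero {zero}  = ≈refl
  ∑-zero {suc k} = ≈trans (m-cong ≈refl ≈refl (∑-zero {k})) (m-idem Z)

  ∑-m : ∀ {k} (a b c : Fin k → F) → ∑ (λ i → m (a i) (b i) (c i)) ≈U m (∑ a) (∑ b) (∑ c)
  ∑-m {zero}  a b c = ≈sym (m-idem Z)
  ∑-m {suc k} a b c = ≈trans (m-cong ≈refl (≈sym (m-idem Z)) (∑-m (tail a) (tail b) (tail c)))
                             (ax (U2 (head a) (head b) (head c) Z Z Z (∑ (tail a)) (∑ (tail b)) (∑ (tail c))))

  ∑-⊕ : ∀ {k} (a b : Fin k → F) → ∑ (λ i → a i ⊕ b i) ≈U ∑ a ⊕ ∑ b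
  ∑-⊕ {k} a b = ≈trans (∑-m a (const Z) b) (m-cong ≈refl (∑-zero {k}) ≈refl)

  ∑-r : ∀ {k} j (a b : Fin k → F) → ∑ (λ i → r j (a i) (b i)) ≈U r j (∑ a) (∑ b)
  ∑-r {zero}  j a b = ≈sym (ax (U3 j Z))
  ∑-r {suc k} j a b = ≈trans (m-cong ≈refl (≈sym (ax (U3 j Z))) (∑-r j (tail a) (tail b)))
                             (ax (U4 j (head a) (head b) Z Z (∑ (tail a)) (∑ (tail b))))

  _if_ : F → Bool → F
  w if true  = w
  w if false = Z

  ∑-if-≟ˡ : ∀ {k} (w : Fin k → F) (j : Fin k) → ∑ (λ i → w i if does (i ≟ j)) ≈U w j
  ∑-if-≟ˡ {suc k} w zero    = ≈trans (m-cong ≈refl ≈refl (∑-zero {k})) (ax (U1a (w zero) Z))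
  ∑-if-≟ˡ {suc k} w (suc j) = ≈trans (ax (U1b _ Z)) (∑-if-≟ˡ (tail w) j)

  ∑-if-≟ʳ : ∀ {k} (w : Fin k → F) (j : Fin k) → ∑ (λ i → w i if does (j ≟ i)) ≈U w j
  ∑-if-≟ʳ {suc k} w zero    = ≈trans (m-cong ≈refl ≈refl (∑-zero {k})) (ax (U1a (w zero) Z))
  ∑-if-≟ʳ {suc k} w (suc j) = ≈trans (ax (U1b _ Z)) (∑-if-≟ʳ (tail w) j)

  X-if-⊙ : ∀ b t → (X if b) ⊙ t ≡ t if b
  X-if-⊙ true  t = ≡.refl
  X-if-⊙ false t = ≡.refl

  InR-X-if : ∀ b → InR (X if b)
  InR-X-if true  = InR-X
  InR-X-if false = InR-Z

  ⟪X-if⟫ : ∀ b a → InR a → a ⟪ ⟨ X if b , Z ⟩ ⟫ ≈U a if b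
  ⟪X-if⟫ true  a a∈R = ≡⇒≈U (⟪⟫-var a λ { vx → ≡.refl ; vz → ≡.refl })
  ⟪X-if⟫ false a a∈R = ≈trans (≡⇒≈U (⟪⟫-ext a λ { vx → ≡.refl ; vz → ≡.refl })) a∈R

  -- R_𝓤^ℓ is a member of 𝓤 with u_j(v) = r_(ι j)·v + e_j; evaluating at zero reads off coordinates in M_𝓤.
  Coordinates : Set
  Coordinates = Fin ℓ → F

  unit : Fin ℓ → Coordinates
  unit j k = X if does (j ≟ k)

  coordinateAlgebra : UAlgebra 0ℓ 0ℓ
  coordinateAlgebra = record
    { setoid = record { Carrier = Coordinates ; _≈_ = λ a b → ∀ k → a k ≈U b k
                      ; isEquivalence = record { refl = λ k → ≈refl ; sym = λ a≈b k → ≈sym (a≈b k)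
                                               ; trans = λ a≈b b≈c k → ≈trans (a≈b k) (b≈c k) } }
    ; uᴬ = λ j v k → r (ι j) (v k) Z ⊕ unit j k
    ; rᴬ = λ j a b k → r j (a k) (b k)
    ; mᴬ = λ a b c k → m (a k) (b k) (c k)
    ; uᴬ-cong = λ j v≈ k → m-cong (r-cong (ι j) (v≈ k) ≈refl) ≈refl ≈refl
    ; rᴬ-cong = λ j a≈ b≈ k → r-cong j (a≈ k) (b≈ k)
    ; mᴬ-cong = λ a≈ b≈ c≈ k → m-cong (a≈ k) (b≈ k) (c≈ k)
    ; U1aᴬ = λ _ _ k → ax (U1a _ _)
    ; U1bᴬ = λ _ _ k → ax (U1b _ _)
    ; U2ᴬ = λ _ _ _ _ _ _ _ _ _ k → ax (U2 _ _ _ _ _ _ _ _ _)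
    ; U3ᴬ = λ j _ k → ax (U3 j _)
    ; U4ᴬ = λ j _ _ _ _ _ _ k → ax (U4 j _ _ _ _ _ _)
    ; U5ᴬ = λ j a b c k →
        ≈trans (solve (m̂ (‵ 0 ⊕̂ ‵ 3) (‵ 1 ⊕̂ ‵ 3) (‵ 2 ⊕̂ ‵ 3)) (m̂ (‵ 0) (‵ 1) (‵ 2) ⊕̂ ‵ 3) tt
                      (r (ι j) (a k) Z ∷ r (ι j) (b k) Z ∷ r (ι j) (c k) Z ∷ unit j k ∷ []))
               (m-cong (≈sym (r-m (ι j) _ _ _)) ≈refl ≈refl)
    ; U6ᴬ = λ j a c k →
        ≈trans (solve (m̂ (‵ 0 ⊕̂ ‵ 3) (‵ 1 ⊕̂ ‵ 3) (‵ 2)) (m̂ (‵ 0) (‵ 1) (‵ 2)) tt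
                      (r (ι j) (a k) Z ∷ r (ι j) (c k) Z ∷ c k ∷ unit j k ∷ []))
               (≈sym (r-affine (ι j) _ _))
    }

  coords : ∀ {V} → Term V → Coordinates
  coords s = ⟦ coordinateAlgebra ⟧ s (const (const Z))

  ⟦_⟧ᶜ : F → (XZ → Coordinates) → Coordinates
  ⟦_⟧ᶜ = ⟦ coordinateAlgebra ⟧

  InR-r : ∀ i {a b} → InR a → InR b → InR (r i a b)
  InR-r i a∈R b∈R = ≈trans (r-cong i a∈R b∈R) (ax (U3 i Z))

  InR-coords : ∀ {V} (s : Term V) k → InR (coords s k)
  InR-coords (var v)   k = InR-Z
  InR-coords (u j s)   k = InR-⊕ {r (ι j) (coords s k) Z} {unit j k}
    (InR-r (ι j) {coords s k} {Z} (InR-coords s k) InR-Z) (InR-X-if (does (j ≟ k)))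
  InR-coords (r j s t) k = InR-r j {coords s k} {coords t k} (InR-coords s k) (InR-coords t k)
  InR-coords (m s t w) k = InR-m {coords s k} {coords t k} {coords w k} (InR-coords s k) (InR-coords t k) (InR-coords w k)

  atZ≈∑-coords : ∀ (s : Term ⊤) → s ⟪ const Z ⟫ ≈U ∑ (λ i → coords s i ⊙ u i Z)
  atZ≈∑-coords (var _)   = ≈sym (∑-zero {ℓ})
  atZ≈∑-coords (u j s)   = begin
    u j (s ⟪ const Z ⟫)
      ≈⟨ u-cong j (atZ≈∑-coords s) ⟩
    u j (∑ c⊙u)
      ≈⟨ u-affine j _ ⟩
    r (ι j) (∑ c⊙u) Z ⊕ u j Z
      ≈⟨ m-cong (r-cong (ι j) ≈refl (∑-zero {ℓ})) ≈refl (∑-if-≟ʳ (λ i → u i Z) j) ⟨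
    r (ι j) (∑ c⊙u) (∑ {ℓ} (const Z)) ⊕ ∑ (λ i → u i Z if does (j ≟ i))
      ≈⟨ m-cong (∑-r (ι j) c⊙u (const Z)) ≈refl (∑-cong λ i → ≡⇒≈U (X-if-⊙ _ (u i Z))) ⟨
    ∑ (λ i → r (ι j) (c⊙u i) Z) ⊕ ∑ (λ i → unit j i ⊙ u i Z)
      ≈⟨ ∑-⊕ (λ i → r (ι j) (c⊙u i) Z) (λ i → unit j i ⊙ u i Z) ⟨
    ∑ (λ i → coords (u j s) i ⊙ u i Z)
      ∎
    where
    open ≈U-Reasoning
    c⊙u = λ i → coords s i ⊙ u i Z
  atZ≈∑-coords (r j s t) = ≈trans (r-cong j (atZ≈∑-coords s) (atZ≈∑-coords t)) (≈sym (∑-r j (c⊙u s) (c⊙u t)))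
    where c⊙u = λ (s : Term ⊤) i → coords s i ⊙ u i Z
  atZ≈∑-coords (m s t w) =
    ≈trans (m-cong (atZ≈∑-coords s) (atZ≈∑-coords t) (atZ≈∑-coords w)) (≈sym (∑-m (c⊙u s) (c⊙u t) (c⊙u w)))
    where c⊙u = λ (s : Term ⊤) i → coords s i ⊙ u i Z

  coords-∑ : ∀ {k} (f : Fin k → F) j → coords (∑ f) j ≡ ∑ (λ i → coords (f i) j)
  coords-∑ {zero}  f j = ≡.refl
  coords-∑ {suc k} f j = ≡.cong (coords (head f) j ⊕_) (coords-∑ (tail f) j)

  coords-InR : ∀ {a} → InR a → ∀ k → coords a k ≈U Z
  coords-InR {a} a∈R k =
    ≈trans (≡⇒≈U (≡.cong (λ c → c k) (≡.sym (⟦⟧-⟪⟫ coordinateAlgebra a (const Z) (const (const Z))))))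
           (⟦⟧-sound coordinateAlgebra a∈R (const (const Z)) k)

  ⟦⟧ᶜ-affine : ∀ s (ρ : XZ → Coordinates) k → ⟦ s ⟧ᶜ ρ k ≈U m (s ⟪ (λ v → ρ v k) ⟫) (atZ s) (coords s k)
  ⟦⟧ᶜ-affine (var v)   ρ k = ≈sym (ax (U1a _ Z))
  ⟦⟧ᶜ-affine (u j s)   ρ k = begin
    r (ι j) (⟦ s ⟧ᶜ ρ k) Z ⊕ unit j k
      ≈⟨ m-cong (≈trans (r-cong (ι j) (⟦⟧ᶜ-affine s ρ k) ≈refl) (r-m (ι j) _ _ _)) ≈refl ≈refl ⟩
    m (r (ι j) P Z) (r (ι j) Q Z) (r (ι j) O Z) ⊕ unit j k
      ≈⟨ solve (m̂ (‵ 0) (‵ 1) (‵ 2) ⊕̂ ‵ 3) (m̂ (‵ 0 ⊕̂ ‵ 4) (‵ 1 ⊕̂ ‵ 4) (‵ 2 ⊕̂ ‵ 3)) tt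
               (r (ι j) P Z ∷ r (ι j) Q Z ∷ r (ι j) O Z ∷ unit j k ∷ u j Z ∷ []) ⟩
    m (r (ι j) P Z ⊕ u j Z) (r (ι j) Q Z ⊕ u j Z) (r (ι j) O Z ⊕ unit j k)
      ≈⟨ m-cong (u-affine j P) (u-affine j Q) ≈refl ⟨
    m (u j P) (u j Q) (r (ι j) O Z ⊕ unit j k)
      ∎
    where
    open ≈U-Reasoning
    P = s ⟪ (λ v → ρ v k) ⟫ ; Q = atZ s ; O = coords s k
  ⟦⟧ᶜ-affine (r j s t) ρ k = ≈trans (r-cong j (⟦⟧ᶜ-affine s ρ k) (⟦⟧ᶜ-affine t ρ k)) (≈sym (ax (U4 j _ _ _ _ _ _)))
  ⟦⟧ᶜ-affine (m s t w) ρ k =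
    ≈trans (m-cong (⟦⟧ᶜ-affine s ρ k) (⟦⟧ᶜ-affine t ρ k) (⟦⟧ᶜ-affine w ρ k)) (ax (U2 _ _ _ _ _ _ _ _ _))

  coords-⊙u : ∀ a i k → InR a → coords (a ⊙ u i Z) k ≈U a if does (i ≟ k)
  coords-⊙u a i k a∈R = begin
    coords (a ⊙ u i Z) k                                       ≡⟨ ≡.cong (λ t → coords t k) (⊙-⟨⟩ a (u i Z)) ⟩
    coords (a ⟪ ⟨ u i Z , Z ⟩ ⟫) k                             ≡⟨ ≡.cong (λ c → c k) (⟦⟧-⟪⟫ coordinateAlgebra a ⟨ u i Z , Z ⟩ _) ⟩
    ⟦ a ⟧ᶜ ρ k                                                 ≈⟨ ⟦⟧ᶜ-affine a ρ k ⟩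
    m (a ⟪ (λ v → ρ v k) ⟫) (atZ a) (coords a k)              ≈⟨ m-cong (⟪⟫-cong a ρₖ≈) a∈R (coords-InR {a} a∈R k) ⟩
    m (a ⟪ ⟨ unit i k , Z ⟩ ⟫) Z Z                             ≈⟨ ax (U1a _ Z) ⟩
    a ⟪ ⟨ unit i k , Z ⟩ ⟫                                     ≈⟨ ⟪X-if⟫ (does (i ≟ k)) a a∈R ⟩
    a if does (i ≟ k)                                          ∎
    where
    open ≈U-Reasoning
    ρ : XZ → Coordinates
    ρ v = coords (⟨ u i Z , Z ⟩ v)
    ρₖ≈ : ∀ v → ρ v k ≈U ⟨ unit i k , Z ⟩ v
    ρₖ≈ vx = ≈trans (m-cong (ax (U3 (ι i) Z)) ≈refl ≈refl) (ax (U1b _ Z))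
    ρₖ≈ vz = ≈refl

  coords-linComb : ∀ a → (∀ i → InR (a i)) → ∀ k → coords (linComb a) k ≈U a k
  coords-linComb a a∈R k = begin
    coords (linComb a) k                          ≡⟨ ≡.cong (λ t → coords t k) (linComb≡∑ a) ⟩
    coords (∑ (λ i → a i ⊙ u i Z)) k              ≡⟨ coords-∑ (λ i → a i ⊙ u i Z) k ⟩
    ∑ (λ i → coords (a i ⊙ u i Z) k)              ≈⟨ ∑-cong (λ i → coords-⊙u (a i) i k (a∈R i)) ⟩
    ∑ (λ i → a i if does (i ≟ k))                 ≈⟨ ∑-if-≟ˡ a k ⟩
    a k                                           ∎
    where open ≈U-Reasoning

  isFreeModule : MIsFreeModule
  isFreeModule = spanning , independent
    where
    spanning : ∀ v → InM v → Σ (Fin ℓ → F) λ a → (∀ i → InR (a i)) × (v ≈U linComb a)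
    spanning v (s , v≈s) =
      coords s , InR-coords s , ≈trans v≈s (≈trans (atZ≈∑-coords s) (≡⇒≈U (≡.sym (linComb≡∑ (coords s)))))
    independent : ∀ a b → (∀ i → InR (a i)) → (∀ i → InR (b i)) → linComb a ≈U linComb b → ∀ i → a i ≈U b i
    independent a b a∈R b∈R a≈b i = ≈trans (≈sym (coords-linComb a a∈R i))
      (≈trans (⟦⟧-sound coordinateAlgebra a≈b (const (const Z)) i) (coords-linComb b b∈R i))

module Congruences (ℓ n : ℕ) (ℓ≤n : ℓ ≤ n) where

  open Variety ℓ n ℓ≤n
  open FreeAlgebra ℓ n ℓ≤n
  open import Data.Product using (Σ; _×_; _,_; proj₁; proj₂; map₁)
  open import Data.Unit using (tt)
  open import Data.List using ([]; _∷_; _++_; map)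
  open import Data.List.Relation.Unary.All as All using (All; []; _∷_)
  open import Data.List.Relation.Unary.All.Properties using (++⁺; map⁺)
  open import Data.Vec using (_∷_; [])
  open import Function using (const; _∘_)
  open import Relation.Binary using (IsEquivalence)
  open import Relation.Binary.PropositionalEquality as ≡ using (_≡_)

  IsEndo⇒≈⟪⟫ : ∀ {f} → IsEndo f → ∀ s → f s ≈U s ⟪ f ∘ var ⟫
  IsEndo⇒≈⟪⟫ f-isEndo (var v)   = ≈refl
  IsEndo⇒≈⟪⟫ f-isEndo (u i s)   = ≈trans (IsEndo.hom-u f-isEndo i s) (u-cong i (IsEndo⇒≈⟪⟫ f-isEndo s))
  IsEndo⇒≈⟪⟫ f-isEndo (r i s t) =
    ≈trans (IsEndo.hom-r f-isEndo i s t) (r-cong i (IsEndo⇒≈⟪⟫ f-isEndo s) (IsEndo⇒≈⟪⟫ f-isEndo t))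
  IsEndo⇒≈⟪⟫ f-isEndo (m s t w) =
    ≈trans (IsEndo.hom-m f-isEndo s t w) (m-cong (IsEndo⇒≈⟪⟫ f-isEndo s) (IsEndo⇒≈⟪⟫ f-isEndo t) (IsEndo⇒≈⟪⟫ f-isEndo w))

  ⟪⟫-isEndo : ∀ σ → IsEndo (_⟪ σ ⟫)
  ⟪⟫-isEndo σ = record
    { well-defined = ⟪⟫-resp-≈U σ ; hom-u = λ _ _ → ≈refl ; hom-r = λ _ _ _ → ≈refl ; hom-m = λ _ _ _ → ≈refl }

  InM⇒⟪⟫ : ∀ {b} → InM b → ∀ (σ : XZ → F) → b ⟪ σ ⟫ ≈U b ⟪ const (σ vz) ⟫
  InM⇒⟪⟫ {b} b∈M σ = ≈trans (⟪⟫-resp-≈U σ (InM⇒≈atZ {b} b∈M)) (≡⇒≈U (⟪⟫-⟪⟫ b (const Z) σ))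

  module CongruenceProperties {θ : Rel₀} (θ-isCongruence : IsCongruence θ) where

    open IsCongruence θ-isCongruence public hiding (isEquivalence)
    open IsCongruence θ-isCongruence using (isEquivalence)
    open IsEquivalence isEquivalence public renaming (refl to θ-refl; sym to θ-sym; trans to θ-trans)

    θ-resp : ∀ {s s′ t t′} → s ≈U s′ → t ≈U t′ → θ s t → θ s′ t′
    θ-resp s≈s′ t≈t′ θst = θ-trans (contains-≈U (≈sym s≈s′)) (θ-trans θst (contains-≈U t≈t′))

    θ-⟪⟫ : ∀ (t : F) {σ τ : XZ → F} → (∀ v → θ (σ v) (τ v)) → θ (t ⟪ σ ⟫) (t ⟪ τ ⟫)
    θ-⟪⟫ (var v)   θστ = θστ v
    θ-⟪⟫ (u i t)   θστ = u-comp i (θ-⟪⟫ t θστ)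
    θ-⟪⟫ (r i s t) θστ = r-comp i (θ-⟪⟫ s θστ) (θ-⟪⟫ t θστ)
    θ-⟪⟫ (m s t w) θστ = m-comp (θ-⟪⟫ s θστ) (θ-⟪⟫ t θστ) (θ-⟪⟫ w θστ)

    θ⇒θZ− : ∀ {s t} → θ s t → θ Z (s − t)
    θ⇒θZ− {s} {t} θst = θ-sym (θ-resp ≈refl (ax (U1b Z t)) (m-comp θst θ-refl θ-refl))

    θZ−⇒θ : ∀ {s t} → θ Z (s − t) → θ s t
    θZ−⇒θ {s} {t} θZ[s−t] = θ-sym (θ-resp (ax (U1b t Z)) (solve (m̂ (m̂ (‵ 0) (‵ 1) ô) ô (‵ 1)) (‵ 0) tt (s ∷ t ∷ []))
                                          (m-comp θZ[s−t] θ-refl (θ-refl {t})))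

    θZ-⊕ : ∀ {a b} → θ Z a → θ Z b → θ Z (a ⊕ b)
    θZ-⊕ θZa θZb = θ-resp (m-idem Z) ≈refl (m-comp θZa θ-refl θZb)

    θZ-⊖ : ∀ {a} → θ Z a → θ Z (⊖ a)
    θZ-⊖ θZa = θ-resp (m-idem Z) ≈refl (m-comp θ-refl θZa θ-refl)

    θZ-⊙ : ∀ a {s} → InR a → θ Z s → θ Z (a ⊙ s)
    θZ-⊙ a {s} a∈R θZs =
      θ-resp a∈R (≡⇒≈U (≡.sym (⊙-⟨⟩ a s))) (θ-⟪⟫ a {const Z} {⟨ s , Z ⟩} λ { vx → θZs ; vz → θ-refl })

  sumProd-++ : ∀ l₁ l₂ → sumProd (l₁ ++ l₂) ≈U sumProd l₁ ⊕ sumProd l₂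
  sumProd-++ []       l₂ = ≈sym (ax (U1b _ Z))
  sumProd-++ (p ∷ l₁) l₂ = ≈trans (m-cong ≈refl ≈refl (sumProd-++ l₁ l₂)) (≈sym (⊕-assoc _ _ _))

  sumProd-⊖ : ∀ l → sumProd (map (map₁ ⊖_) l) ≈U ⊖ sumProd l
  sumProd-⊖ []            = ≈sym (m-idem Z)
  sumProd-⊖ ((a , b) ∷ l) = ≈trans (m-cong ≈refl ≈refl (sumProd-⊖ l))
    (solve (⊖̂ ‵ 0 ⊕̂ ⊖̂ ‵ 1) (⊖̂ (‵ 0 ⊕̂ ‵ 1)) tt (a ⊙ b ∷ sumProd l ∷ []))

  sumProd-⊙ : ∀ a l → InR a → sumProd (map (map₁ (a ⊙_)) l) ≈U a ⊙ sumProd l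
  sumProd-⊙ a []            a∈R = ≈sym (⊙-zeroʳ a a∈R)
  sumProd-⊙ a ((x , y) ∷ l) a∈R = ≈trans (m-cong (⊙-assoc a x y) (≈sym (⊙-zeroʳ a a∈R)) (sumProd-⊙ a l a∈R))
                                         (≈sym (⊙-m a _ _ _ a∈R))

  module _ {I : F → Set} where

    InIM-resp : ∀ {s t} → s ≈U t → InIM I s → InIM I t
    InIM-resp s≈t (l , l∈IM , s≈l) = l , l∈IM , ≈trans (≈sym s≈t) s≈l

    InIM-Z : InIM I Z
    InIM-Z = [] , [] , ≈refl

    InIM-⊕ : ∀ {s t} → InIM I s → InIM I t → InIM I (s ⊕ t)
    InIM-⊕ (l₁ , l₁∈ , s≈) (l₂ , l₂∈ , t≈) =
      l₁ ++ l₂ , ++⁺ l₁∈ l₂∈ , ≈trans (m-cong s≈ ≈refl t≈) (≈sym (sumProd-++ l₁ l₂))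

    InIM-⊖ : IsIdeal I → ∀ {s} → InIM I s → InIM I (⊖ s)
    InIM-⊖ I-ideal (l , l∈ , s≈) = map (map₁ ⊖_) l , map⁺ (All.map (λ (a∈I , b∈M) → IsIdeal.neg-cl I-ideal _ a∈I , b∈M) l∈) ,
      ≈trans (m-cong ≈refl s≈ ≈refl) (≈sym (sumProd-⊖ l))

    InIM-⊙ : IsIdeal I → ∀ a {s} → InR a → InIM I s → InIM I (a ⊙ s)
    InIM-⊙ I-ideal a a∈R (l , l∈ , s≈) =
      map (map₁ (a ⊙_)) l , map⁺ (All.map (λ (x∈I , y∈M) → IsIdeal.left-cl I-ideal a _ a∈R x∈I , y∈M) l∈) ,
      ≈trans (⊙-congʳ a s≈) (≈sym (sumProd-⊙ a l a∈R))

    InIM-⊙M : ∀ {i v} → I i → InM v → InIM I (i ⊙ v)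
    InIM-⊙M i∈I v∈M = _ ∷ [] , (i∈I , v∈M) ∷ [] , ≈sym (ax (U1a _ Z))

    InIM⇒InM : ∀ {t} → InIM I t → InM t
    InIM⇒InM (l , l∈ , t≈) = InM-resp (≈sym t≈) (sumProd∈M l l∈)
      where
      sumProd∈M : ∀ l → All (λ p → I (proj₁ p) × InM (proj₂ p)) l → InM (sumProd l)
      sumProd∈M []            []               = InM-Z
      sumProd∈M ((a , b) ∷ l) ((_ , b∈M) ∷ l∈) = InM-⊕ (InM-⊙ a b∈M) (sumProd∈M l l∈)

  InIM-mono : ∀ {I I′ : F → Set} → (∀ t → I t → I′ t) → ∀ {s} → InIM I s → InIM I′ s
  InIM-mono I⊆I′ (l , l∈ , s≈) = l , All.map (λ (a∈I , b∈M) → I⊆I′ _ a∈I , b∈M) l∈ , s≈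

  -- Given an ideal J and a submodule N satisfying (d) and (e), "s − t ∈ J + N" is a fully invariant congruence.
  module SumCongruence {J N : F → Set} (J-ideal : IsIdeal J) (N-submodule : IsSubmodule N)
                       (JM⊆N : ∀ j v → J j → InM v → N (j ⊙ v)) (defect-N⊆J : ∀ f → N f → J (defect f)) where

    private
      module J = IsIdeal J-ideal
      module N = IsSubmodule N-submodule

    InJ+N : F → Set
    InJ+N t = Σ F λ a → Σ F λ b → J a × N b × (t ≈U a ⊕ b)

    InJ+N-resp : ∀ {s t} → s ≈U t → InJ+N s → InJ+N t
    InJ+N-resp s≈t (a , b , a∈J , b∈N , s≈a+b) = a , b , a∈J , b∈N , ≈trans (≈sym s≈t) s≈a+b

    InJ+N-J : ∀ {a} → J a → InJ+N a
    InJ+N-J {a} a∈J = a , Z , a∈J , N.zero , ≈sym (ax (U1a a Z))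

    InJ+N-N : ∀ {b} → N b → InJ+N b
    InJ+N-N {b} b∈N = Z , b , J.zero , b∈N , ≈sym (ax (U1b b Z))

    InJ+N-⊕ : ∀ {s t} → InJ+N s → InJ+N t → InJ+N (s ⊕ t)
    InJ+N-⊕ (a , b , a∈J , b∈N , s≈) (a′ , b′ , a′∈J , b′∈N , t≈) =
      a ⊕ a′ , b ⊕ b′ , J.+-cl _ _ a∈J a′∈J , N.+-cl _ _ b∈N b′∈N ,
      ≈trans (m-cong s≈ ≈refl t≈)
             (solve ((‵ 0 ⊕̂ ‵ 1) ⊕̂ (‵ 2 ⊕̂ ‵ 3)) ((‵ 0 ⊕̂ ‵ 2) ⊕̂ (‵ 1 ⊕̂ ‵ 3)) tt (a ∷ b ∷ a′ ∷ b′ ∷ []))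

    InJ+N-⊖ : ∀ {s} → InJ+N s → InJ+N (⊖ s)
    InJ+N-⊖ (a , b , a∈J , b∈N , s≈) = ⊖ a , ⊖ b , J.neg-cl _ a∈J , N.neg-cl _ b∈N ,
      ≈trans (m-cong ≈refl s≈ ≈refl) (solve (⊖̂ (‵ 0 ⊕̂ ‵ 1)) (⊖̂ ‵ 0 ⊕̂ ⊖̂ ‵ 1) tt (a ∷ b ∷ []))

    InJ+N-r : ∀ i {t} → InJ+N t → InJ+N (r i t Z)
    InJ+N-r i (a , b , a∈J , b∈N , t≈) =
      r i a Z , r i b Z , J.left-cl (rgen i) a (InR-rgen i) a∈J , N.act-cl (rgen i) b (InR-rgen i) b∈N ,
      ≈trans (r-cong i t≈ ≈refl) (≈trans (r-m i a Z b) (m-cong ≈refl (ax (U3 i Z)) ≈refl))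

    InJ+N-J⊙ : ∀ a w → J a → InJ+N (a ⊙ w)
    InJ+N-J⊙ a w a∈J =
      a ⊙ ringPart w , a ⊙ atZ w , J.right-cl (ringPart w) a (InR-ringPart w) a∈J , JM⊆N a (atZ w) a∈J (InM-atZ w) ,
      ≈trans (⊙-congʳ a (ringPart⊕atZ w)) (⊙-distribˡ a (ringPart w) (atZ w) (J.⊆R a a∈J))

    _∼_ : Rel₀
    s ∼ t = InJ+N (s − t)

    ∼-isCongruence : IsCongruence _∼_
    ∼-isCongruence = record
      { isEquivalence = record
        { refl  = λ {s} → InJ+N-resp (≈sym (ax (U1b Z s))) (InJ+N-J J.zero)
        ; sym   = λ {s} {t} s∼t →
            InJ+N-resp (solve (⊖̂ m̂ (‵ 0) (‵ 1) ô) (m̂ (‵ 1) (‵ 0) ô) tt (s ∷ t ∷ [])) (InJ+N-⊖ s∼t)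
        ; trans = λ {s} {t} {w} s∼t t∼w →
            InJ+N-resp (solve (m̂ (‵ 0) (‵ 1) ô ⊕̂ m̂ (‵ 1) (‵ 2) ô) (m̂ (‵ 0) (‵ 2) ô) tt (s ∷ t ∷ w ∷ []))
                       (InJ+N-⊕ s∼t t∼w) }
      ; contains-≈U = λ {s} {t} s≈t → InJ+N-resp (≈sym (≈trans (m-cong s≈t ≈refl ≈refl) (ax (U1b Z t)))) (InJ+N-J J.zero)
      ; u-comp = λ i {s} {t} s∼t → InJ+N-resp (≈sym (u-difference i s t)) (InJ+N-r (ι i) s∼t)
      ; r-comp = λ i {s} {s′} {t} {t′} s∼s′ t∼t′ → InJ+N-resp (≈sym (r-difference i s t s′ t′))
                   (InJ+N-⊕ (InJ+N-r i s∼s′) (InJ+N-⊕ t∼t′ (InJ+N-⊖ (InJ+N-r i t∼t′))))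
      ; m-comp = λ {s} {s′} {t} {t′} {w} {w′} s∼s′ t∼t′ w∼w′ → InJ+N-resp (≈sym (m-difference s t w s′ t′ w′))
                   (InJ+N-⊕ (InJ+N-⊕ s∼s′ (InJ+N-⊖ t∼t′)) w∼w′)
      }

    -- Substituting q for z in b ∈ N moves it by defect(b) · q ∈ J + N.
    InJ+N-N⟪⟫ : ∀ {b} q → N b → InJ+N ((b ⟪ const q ⟫) − q)
    InJ+N-N⟪⟫ {b} q b∈N = InJ+N-resp (≈sym b⟪q⟫−q≈) (InJ+N-⊕ (InJ+N-J⊙ (defect b) q (defect-N⊆J b b∈N)) (InJ+N-N b∈N))
      where
      b∈M = N.⊆M b b∈N
      defect-b⊙q : defect b ⊙ q ≈U ((b ⟪ const q ⟫) ⊕ (⊖ b)) ⊕ (⊖ q)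
      defect-b⊙q = ≈trans (≡⇒≈U (⊙-⟨⟩ (defect b) q))
        (m-cong (m-cong (≡⇒≈U (⟪⟫-⟪⟫ b (const X) ⟨ q , Z ⟩)) ≈refl
                        (m-cong ≈refl (≈trans (InM⇒⟪⟫ b∈M ⟨ q , Z ⟩) (≈sym (InM⇒≈atZ {b} b∈M))) ≈refl)) ≈refl ≈refl)
      b⟪q⟫−q≈ : (b ⟪ const q ⟫) − q ≈U (defect b ⊙ q) ⊕ b
      b⟪q⟫−q≈ = ≈trans (solve (m̂ (‵ 0) (‵ 2) ô) (((‵ 0 ⊕̂ ⊖̂ ‵ 1) ⊕̂ ⊖̂ ‵ 2) ⊕̂ ‵ 1) tt
                              (b ⟪ const q ⟫ ∷ b ∷ q ∷ []))
                       (m-cong (≈sym defect-b⊙q) ≈refl ≈refl)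

    ∼-fullyInvariant : FullyInvariant _∼_
    ∼-fullyInvariant f f-isEndo {s} {t} (a , b , a∈J , b∈N , s−t≈a⊕b) = InJ+N-resp (≈sym fs−ft≈)
      (InJ+N-⊕ (InJ+N-J⊙ a (p − q) a∈J) (InJ+N-N⟪⟫ q b∈N))
      where
      σ = f ∘ var
      p = σ vx
      q = σ vz
      a⟪σ⟫≈ : a ⟪ σ ⟫ ≈U (a ⊙ (p − q)) ⊕ q
      a⟪σ⟫≈ = ≈trans (≡⇒≈U (⟪⟫-ext a λ { vx → ≡.refl ; vz → ≡.refl })) (InR⇒⟪⟨⟩⟫ a p q (J.⊆R a a∈J))
      fs−ft≈ : f s − f t ≈U (a ⊙ (p − q)) ⊕ ((b ⟪ const q ⟫) − q)
      fs−ft≈ = begin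
        f s − f t
          ≈⟨ m-cong (IsEndo⇒≈⟪⟫ f-isEndo s) (IsEndo⇒≈⟪⟫ f-isEndo t) ≈refl ⟩
        (s ⟪ σ ⟫) − (t ⟪ σ ⟫)
          ≈⟨ solve (m̂ (‵ 0) (‵ 1) ô) (m̂ (m̂ (‵ 0) (‵ 1) (‵ 2)) (‵ 2) ô) tt (s ⟪ σ ⟫ ∷ t ⟪ σ ⟫ ∷ q ∷ []) ⟩
        ((s − t) ⟪ σ ⟫) − q
          ≈⟨ m-cong (⟪⟫-resp-≈U σ s−t≈a⊕b) ≈refl ≈refl ⟩
        m (a ⟪ σ ⟫) q (b ⟪ σ ⟫) − q
          ≈⟨ m-cong (m-cong a⟪σ⟫≈ ≈refl (InM⇒⟪⟫ (N.⊆M b b∈N) σ)) ≈refl ≈refl ⟩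
        m ((a ⊙ (p − q)) ⊕ q) q (b ⟪ const q ⟫) − q
          ≈⟨ solve (m̂ (m̂ (‵ 0 ⊕̂ ‵ 1) (‵ 1) (‵ 2)) (‵ 1) ô) (‵ 0 ⊕̂ m̂ (‵ 2) (‵ 1) ô) tt
                   (a ⊙ (p − q) ∷ q ∷ b ⟪ const q ⟫ ∷ []) ⟩
        (a ⊙ (p − q)) ⊕ ((b ⟪ const q ⟫) − q)
          ∎
        where open ≈U-Reasoning

module FullyInvariantCongruences (ℓ n : ℕ) (ℓ≤n : ℓ ≤ n) where

  open Variety ℓ n ℓ≤n
  open FreeAlgebra ℓ n ℓ≤n
  open Congruences ℓ n ℓ≤n
  open import Data.Product using (Σ; _×_; _,_; proj₁; proj₂)
  open import Data.List using ([]; _∷_)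
  open import Data.List.Relation.Unary.All using (All; []; _∷_)
  open import Function using (const)
  open import Function.Bundles using (_⇔_; mk⇔; Equivalence)
  open import Relation.Binary.PropositionalEquality as ≡ using (_≡_)

  module FromFullyInvariant {θ : Rel₀} (θ-isCongruence : IsCongruence θ) (θ-fi : FullyInvariant θ) where

    open CongruenceProperties θ-isCongruence

    θ-⟪⟫ˡ : ∀ (σ : XZ → F) {s t} → θ s t → θ (s ⟪ σ ⟫) (t ⟪ σ ⟫)
    θ-⟪⟫ˡ σ = θ-fi (_⟪ σ ⟫) (⟪⟫-isEndo σ)

    θZ-⊙ʳ : ∀ i v → θ Z i → θ Z (i ⊙ v)
    θZ-⊙ʳ i v θZi = θ-resp ≈refl (≡⇒≈U (≡.sym (⊙-⟨⟩ i v))) (θ-⟪⟫ˡ ⟨ v , Z ⟩ θZi)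

    I-isIdeal : IsIdeal (Iθ θ)
    I-isIdeal = record
      { ⊆R       = λ t → proj₂
      ; resp     = λ s t s≈t (θZs , s∈R) → θ-resp ≈refl s≈t θZs , InR-resp s≈t s∈R
      ; zero     = θ-refl , InR-Z
      ; +-cl     = λ s t (θZs , s∈R) (θZt , t∈R) → θZ-⊕ θZs θZt , InR-⊕ {s} {t} s∈R t∈R
      ; neg-cl   = λ s (θZs , s∈R) → θZ-⊖ θZs , InR-⊖ {s} s∈R
      ; left-cl  = λ a s a∈R (θZs , s∈R) → θZ-⊙ a a∈R θZs , InR-⊙ a s a∈R s∈R
      ; right-cl = λ a s a∈R (θZs , s∈R) → θZ-⊙ʳ s a θZs , InR-⊙ s a s∈R a∈R
      }

    N-isSubmodule : IsSubmodule (Nθ θ)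
    N-isSubmodule = record
      { ⊆M     = λ t → proj₂
      ; resp   = λ s t s≈t (θZs , s∈M) → θ-resp ≈refl s≈t θZs , InM-resp s≈t s∈M
      ; zero   = θ-refl , InM-Z
      ; +-cl   = λ s t (θZs , s∈M) (θZt , t∈M) → θZ-⊕ θZs θZt , InM-⊕ s∈M t∈M
      ; neg-cl = λ s (θZs , s∈M) → θZ-⊖ θZs , InM-⊖ s∈M
      ; act-cl = λ a v a∈R (θZv , v∈M) → θZ-⊙ a a∈R θZv , InM-⊙ a v∈M
      }

    ringPart∈I : ∀ {t} → θ Z t → Iθ θ (ringPart t)
    ringPart∈I {t} θZt = θ-resp (m-idem Z) ≈refl (m-comp θZt (θ-⟪⟫ˡ (const Z) θZt) θ-refl) , InR-ringPart t

    atZ∈N : ∀ {t} → θ Z t → Nθ θ (atZ t)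
    atZ∈N {t} θZt = θ-⟪⟫ˡ (const Z) θZt , InM-atZ t

    z/θ⇔I+N : ∀ t → θ Z t ⇔ (Σ F λ a → Σ F λ b → Iθ θ a × Nθ θ b × (t ≈U a ⊕ b))
    z/θ⇔I+N t = mk⇔ (λ θZt → ringPart t , atZ t , ringPart∈I θZt , atZ∈N θZt , ringPart⊕atZ t)
                    (λ (a , b , (θZa , _) , (θZb , _) , t≈a⊕b) → θ-resp ≈refl (≈sym t≈a⊕b) (θZ-⊕ θZa θZb))

    IM⊆N : ∀ t → InIM (Iθ θ) t → Nθ θ t
    IM⊆N t (l , l∈ , t≈) = resp _ _ (≈sym t≈) (sumProd∈N l l∈)
      where
      open IsSubmodule N-isSubmodule
      sumProd∈N : ∀ l → All (λ p → Iθ θ (proj₁ p) × InM (proj₂ p)) l → Nθ θ (sumProd l)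
      sumProd∈N []            []                          = θ-refl , InM-Z
      sumProd∈N ((i , v) ∷ l) (((θZi , _) , v∈M) ∷ l∈) = +-cl _ _ (θZ-⊙ʳ i v θZi , InM-⊙ i v∈M) (sumProd∈N l l∈)

    -- z θ f gives x θ f(x), hence defect z θ defect f.
    defect-N⊆I : ∀ f → Nθ θ f → Iθ θ (defect f)
    defect-N⊆I f (θZf , _) =
      θ-resp defect-Z ≈refl (m-comp (m-comp (θ-⟪⟫ˡ (const X) θZf) θ-refl (m-comp θ-refl θZf θ-refl)) θ-refl θ-refl) ,
      InR-defect f

    conditions : Conditions θ
    conditions = I-isIdeal , N-isSubmodule , z/θ⇔I+N , IM⊆N , defect-N⊆I

  module FromConditions {θ : Rel₀} (θ-isCongruence : IsCongruence θ) (θ-conditions : Conditions θ) where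

    open CongruenceProperties θ-isCongruence
    I-isIdeal     = proj₁ θ-conditions
    N-isSubmodule = proj₁ (proj₂ θ-conditions)
    z/θ⇔I+N       = proj₁ (proj₂ (proj₂ θ-conditions))
    IM⊆N          = proj₁ (proj₂ (proj₂ (proj₂ θ-conditions)))
    defect-N⊆I    = proj₂ (proj₂ (proj₂ (proj₂ θ-conditions)))

    open SumCongruence I-isIdeal N-isSubmodule (λ j v j∈I v∈M → IM⊆N (j ⊙ v) (InIM-⊙M j∈I v∈M)) defect-N⊆I

    θ⇒∼ : ∀ {s t} → θ s t → s ∼ t
    θ⇒∼ θst = Equivalence.to (z/θ⇔I+N _) (θ⇒θZ− θst)

    ∼⇒θ : ∀ {s t} → s ∼ t → θ s t
    ∼⇒θ s∼t = θZ−⇒θ (Equivalence.from (z/θ⇔I+N _) s∼t)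

    fullyInvariant : FullyInvariant θ
    fullyInvariant f f-isEndo θst = ∼⇒θ (∼-fullyInvariant f f-isEndo (θ⇒∼ θst))

  fullyInvariant⇔conditions : Part4
  fullyInvariant⇔conditions θ θ-isCongruence =
    mk⇔ (FromFullyInvariant.conditions θ-isCongruence) (FromConditions.fullyInvariant θ-isCongruence)

module FiniteGeneration (ℓ n : ℕ) (ℓ≤n : ℓ ≤ n) where

  open Variety ℓ n ℓ≤n
  open FreeAlgebra ℓ n ℓ≤n
  open Congruences ℓ n ℓ≤n
  open FullyInvariantCongruences ℓ n ℓ≤n
  open import Data.Product using (Σ; _×_; _,_; proj₁; proj₂; uncurry; map₁)
  open import Data.Unit using (tt)
  open import Data.List using (List; []; _∷_; _++_; map)
  open import Data.List.Membership.Propositional using (_∈_)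
  open import Data.List.Membership.Propositional.Properties using (∈-map⁺)
  open import Data.List.Relation.Unary.All as All using (All; []; _∷_)
  open import Data.List.Relation.Unary.All.Properties using (++⁺; ++⁻; map⁺; map⁻)
  open import Data.Vec using (_∷_; [])
  open import Function using (_∘_)
  open import Function.Bundles using (mk⇔; Equivalence)

  SpannedModulo : (F → Set) → List F → F → Set
  SpannedModulo J G t = Σ (List (F × F)) λ l → All (λ p → InR (proj₁ p) × proj₂ p ∈ G) l × InIM J (t ⊕ (⊖ sumProd l))

  -- For an ideal J and G ⊆ M_𝓤, the preimage of the span of G in M_𝓤 / J M_𝓤.
  module Span {J : F → Set} (J-ideal : IsIdeal J) (G : List F) (G⊆M : All InM G) where

    private module J = IsIdeal J-ideal

    N′ : F → Set
    N′ = SpannedModulo J G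

    sumProd∈M : ∀ l → All (λ p → InR (proj₁ p) × proj₂ p ∈ G) l → InM (sumProd l)
    sumProd∈M []            []              = InM-Z
    sumProd∈M ((a , g) ∷ l) ((_ , g∈G) ∷ l∈) = InM-⊕ (InM-⊙ a (All.lookup G⊆M g∈G)) (sumProd∈M l l∈)

    N′-isSubmodule : IsSubmodule N′
    N′-isSubmodule = record
      { ⊆M = λ t (l , l∈ , t−l∈JM) →
          InM-resp (solve ((‵ 0 ⊕̂ ⊖̂ ‵ 1) ⊕̂ ‵ 1) (‵ 0) tt (t ∷ sumProd l ∷ []))
                   (InM-⊕ (InIM⇒InM t−l∈JM) (sumProd∈M l l∈))
      ; resp = λ s t s≈t (l , l∈ , s−l∈JM) → l , l∈ , InIM-resp (m-cong s≈t ≈refl ≈refl) s−l∈JM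
      ; zero = [] , [] , InIM-resp (≈sym (⊖-inverseʳ Z)) InIM-Z
      ; +-cl = λ s t (l₁ , l₁∈ , s−l₁∈JM) (l₂ , l₂∈ , t−l₂∈JM) → l₁ ++ l₂ , ++⁺ l₁∈ l₂∈ ,
          InIM-resp (≈trans (solve ((‵ 0 ⊕̂ ⊖̂ ‵ 2) ⊕̂ (‵ 1 ⊕̂ ⊖̂ ‵ 3)) ((‵ 0 ⊕̂ ‵ 1) ⊕̂ ⊖̂ (‵ 2 ⊕̂ ‵ 3)) tt
                                    (s ∷ t ∷ sumProd l₁ ∷ sumProd l₂ ∷ []))
                             (m-cong ≈refl ≈refl (m-cong ≈refl (≈sym (sumProd-++ l₁ l₂)) ≈refl)))
                    (InIM-⊕ s−l₁∈JM t−l₂∈JM)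
      ; neg-cl = λ s (l , l∈ , s−l∈JM) →
          map (map₁ ⊖_) l , map⁺ (All.map (λ {p} (a∈R , g∈G) → InR-⊖ {proj₁ p} a∈R , g∈G) l∈) ,
          InIM-resp (≈trans (solve (⊖̂ (‵ 0 ⊕̂ ⊖̂ ‵ 1)) (⊖̂ ‵ 0 ⊕̂ ⊖̂ ⊖̂ ‵ 1) tt (s ∷ sumProd l ∷ []))
                            (m-cong ≈refl ≈refl (m-cong ≈refl (≈sym (sumProd-⊖ l)) ≈refl)))
                    (InIM-⊖ J-ideal s−l∈JM)
      ; act-cl = λ a v a∈R (l , l∈ , v−l∈JM) →
          map (map₁ (a ⊙_)) l , map⁺ (All.map (λ (x∈R , g∈G) → InR-⊙ a _ a∈R x∈R , g∈G) l∈) ,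
          InIM-resp (≈trans (⊙-m a _ _ _ a∈R) (m-cong ≈refl (⊙-zeroʳ a a∈R)
                            (≈trans (⊙-m a _ _ _ a∈R) (m-cong (⊙-zeroʳ a a∈R) (≈sym (sumProd-⊙ a l a∈R)) (⊙-zeroʳ a a∈R)))))
                    (InIM-⊙ J-ideal a a∈R v−l∈JM)
      }

    JM⊆N′ : ∀ j v → J j → InM v → N′ (j ⊙ v)
    JM⊆N′ j v j∈J v∈M = [] , [] , InIM-resp (≈sym (≈trans (m-cong ≈refl ≈refl (m-idem Z)) (ax (U1a _ Z)))) (InIM-⊙M j∈J v∈M)

    G⊆N′ : ∀ {g} → g ∈ G → N′ g
    G⊆N′ {g} g∈G = (X , g) ∷ [] , (InR-X , g∈G) ∷ [] ,
      InIM-resp (solve ô (‵ 0 ⊕̂ ⊖̂ (‵ 0 ⊕̂ ô)) tt (g ∷ [])) InIM-Z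

    defect-sumProd : ∀ l → All (λ p → J (defect (proj₁ p ⊙ proj₂ p))) l → J (defect (sumProd l))
    defect-sumProd []            []          = J.resp _ _ (≈sym defect-Z) J.zero
    defect-sumProd ((a , b) ∷ l) (a⊙b∈J ∷ l∈) = J.resp _ _ (≈sym (defect-⊕ _ _)) (J.+-cl _ _ a⊙b∈J (defect-sumProd l l∈))

    -- defect is additive and R-linear, and vanishes up to J on J M_𝓤 since J is a right ideal.
    defect-N′⊆J : All (J ∘ defect) G → ∀ f → N′ f → J (defect f)
    defect-N′⊆J defect-G⊆J f (l , l∈ , (l′ , l′∈ , f−l≈l′)) =
      J.resp _ _ (≈sym (≈trans (defect-resp f≈) (defect-⊕ _ _)))
        (J.+-cl _ _ (J.resp _ _ (≈sym (defect-resp f−l≈l′)) (defect-sumProd l′ (All.map (λ {p} → defect-JM {p}) l′∈)))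
                    (defect-sumProd l (All.map (λ {p} → defect-RG {p}) l∈)))
      where
      f≈ : f ≈U (f ⊕ (⊖ sumProd l)) ⊕ sumProd l
      f≈ = ≈sym (solve ((‵ 0 ⊕̂ ⊖̂ ‵ 1) ⊕̂ ‵ 1) (‵ 0) tt (f ∷ sumProd l ∷ []))
      defect-JM : ∀ {p} → J (proj₁ p) × InM (proj₂ p) → J (defect (proj₁ p ⊙ proj₂ p))
      defect-JM {a , b} (a∈J , _) =
        J.resp (a ⊙ defect b) (defect (a ⊙ b)) (≈sym (defect-⊙ a b (J.⊆R a a∈J))) (J.right-cl (defect b) a (InR-defect b) a∈J)
      defect-RG : ∀ {p} → InR (proj₁ p) × proj₂ p ∈ G → J (defect (proj₁ p ⊙ proj₂ p))
      defect-RG {a , g} (a∈R , g∈G) =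
        J.resp (a ⊙ defect g) (defect (a ⊙ g)) (≈sym (defect-⊙ a g a∈R)) (J.left-cl a (defect g) a∈R (All.lookup defect-G⊆J g∈G))

  moduleGenerators : List (F × F) → List F
  moduleGenerators = map (atZ ∘ uncurry _−_)

  ringGenerators : List (F × F) → List F
  ringGenerators L = map (ringPart ∘ uncurry _−_) L ++ map defect (moduleGenerators L)

  -- Any ideal J ⊇ ringGenerators L yields a fully invariant congruence containing L.
  module Generated (L : List (F × F)) {J : F → Set} (J-ideal : IsIdeal J) (J⊇gens : All J (ringGenerators L)) where

    G⊆M : All InM (moduleGenerators L)
    G⊆M = map⁺ (All.universal (InM-atZ ∘ uncurry _−_) L)

    open Span J-ideal (moduleGenerators L) G⊆M public

    private
      J⊇ringParts = proj₁ (++⁻ (map (ringPart ∘ uncurry _−_) L) J⊇gens)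
      J⊇defects   = map⁻ (proj₂ (++⁻ (map (ringPart ∘ uncurry _−_) L) J⊇gens))

    open SumCongruence J-ideal N′-isSubmodule JM⊆N′ (defect-N′⊆J J⊇defects) public

    ∼-contains : All (uncurry _∼_) L
    ∼-contains = All.tabulate λ {(s , t)} st∈L →
      ringPart (s − t) , atZ (s − t) , All.lookup (map⁻ J⊇ringParts) st∈L ,
      G⊆N′ (∈-map⁺ (atZ ∘ uncurry _−_) st∈L) , ringPart⊕atZ (s − t)

  module FromFinitelyGenerated {θ : Rel₀} (θ-isCongruence : IsCongruence θ) (θ-fi : FullyInvariant θ) where

    open CongruenceProperties θ-isCongruence using (θ⇒θZ−)
    open FromFullyInvariant θ-isCongruence θ-fi

    I⊇ringGenerators : ∀ {L} → All (uncurry θ) L → All (Iθ θ) (ringGenerators L)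
    I⊇ringGenerators θ⊇L = ++⁺ (map⁺ (All.map (ringPart∈I ∘ θ⇒θZ−) θ⊇L))
                               (map⁺ (map⁺ (All.map (λ θst → defect-N⊆I _ (atZ∈N (θ⇒θZ− θst))) θ⊇L)))

    N⊇moduleGenerators : ∀ {L} → All (uncurry θ) L → All (Nθ θ) (moduleGenerators L)
    N⊇moduleGenerators θ⊇L = map⁺ (All.map (atZ∈N ∘ θ⇒θZ−) θ⊇L)

    -- θ is contained in every congruence Generated.∼, and z − t ∈ J + N′ splits along R_𝓤 ⊕ M_𝓤.
    finitelyGenerated : FinGenFI θ → FinGenIdeal (Iθ θ) × FinGenQuotient (Nθ θ) (Iθ θ)
    finitelyGenerated (L , θ⊇L , θ-least) =
      (ringGenerators L , I⊇ringGenerators θ⊇L , I⊆J) , (moduleGenerators L , N⊇moduleGenerators θ⊇L , N-spanned)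
      where
      θ⊆∼ : ∀ {J} (J-ideal : IsIdeal J) (J⊇gens : All J (ringGenerators L)) →
            ∀ {s t} → θ s t → Generated._∼_ L J-ideal J⊇gens s t
      θ⊆∼ J-ideal J⊇gens {s} {t} = θ-least _ (Generated.∼-isCongruence L J-ideal J⊇gens)
        (Generated.∼-fullyInvariant L J-ideal J⊇gens) (Generated.∼-contains L J-ideal J⊇gens) s t

      I⊆J : ∀ J → IsIdeal J → All J (ringGenerators L) → ∀ t → Iθ θ t → J t
      I⊆J J J-ideal J⊇gens t (θZt , t∈R) with θ⊆∼ J-ideal J⊇gens θZt
      ... | a , b , a∈J , b∈N′ , Z−t≈a⊕b =
        IsIdeal.resp J-ideal (⊖ a) t ⊖a≈t (IsIdeal.neg-cl J-ideal a a∈J)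
        where
        b∈R : InR b
        b∈R = InR-resp (≈trans (m-cong Z−t≈a⊕b ≈refl ≈refl) (solve (m̂ (‵ 0 ⊕̂ ‵ 1) (‵ 0) ô) (‵ 1) tt (a ∷ b ∷ [])))
                       (InR-m {Z − t} {a} {Z} (InR-⊖ {t} t∈R) (IsIdeal.⊆R J-ideal a a∈J) InR-Z)
        b≈Z : b ≈U Z
        b≈Z = InR∧InM⇒≈Z b∈R (IsSubmodule.⊆M (Generated.N′-isSubmodule L J-ideal J⊇gens) b b∈N′)
        ⊖a≈t : ⊖ a ≈U t
        ⊖a≈t = ≈trans (m-cong ≈refl (≈sym (≈trans Z−t≈a⊕b (≈trans (m-cong ≈refl ≈refl b≈Z) (ax (U1a a Z))))) ≈refl)
                      (solve (⊖̂ m̂ ô (‵ 0) ô) (‵ 0) tt (t ∷ []))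

      N-spanned : ∀ t → Nθ θ t → SpannedModulo (Iθ θ) (moduleGenerators L) t
      N-spanned t (θZt , t∈M) with θ⊆∼ I-isIdeal (I⊇ringGenerators θ⊇L) θZt
      ... | a , b , (_ , a∈R) , (l , l∈ , b−l∈IM) , Z−t≈a⊕b =
        map (map₁ ⊖_) l , map⁺ (All.map (λ {p} (r∈R , g∈G) → InR-⊖ {proj₁ p} r∈R , g∈G) l∈) ,
        InIM-resp ⊖[b−l]≈ (InIM-⊖ I-isIdeal b−l∈IM)
        where
        b∈M : InM b
        b∈M = IsSubmodule.⊆M (Generated.N′-isSubmodule L I-isIdeal (I⊇ringGenerators θ⊇L)) b (l , l∈ , b−l∈IM)
        a∈M : InM a
        a∈M = InM-resp (≈trans (m-cong Z−t≈a⊕b ≈refl ≈refl) (solve (m̂ (‵ 0 ⊕̂ ‵ 1) (‵ 1) ô) (‵ 0) tt (a ∷ b ∷ [])))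
                       (InM-m (InM-⊖ t∈M) b∈M InM-Z)
        ⊖t≈b : ⊖ t ≈U b
        ⊖t≈b = ≈trans Z−t≈a⊕b (≈trans (m-cong (InR∧InM⇒≈Z a∈R a∈M) ≈refl ≈refl) (ax (U1b b Z)))
        ⊖[b−l]≈ : ⊖ (b ⊕ (⊖ sumProd l)) ≈U t ⊕ (⊖ sumProd (map (map₁ ⊖_) l))
        ⊖[b−l]≈ = ≈trans (m-cong ≈refl (m-cong (≈sym ⊖t≈b) ≈refl ≈refl) ≈refl)
                  (≈trans (solve (⊖̂ (⊖̂ ‵ 0 ⊕̂ ⊖̂ ‵ 1)) (‵ 0 ⊕̂ ⊖̂ ⊖̂ ‵ 1) tt (t ∷ sumProd l ∷ []))
                          (m-cong ≈refl ≈refl (m-cong ≈refl (≈sym (sumProd-⊖ l)) ≈refl)))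

  module FromFinitelyGeneratedParts {θ : Rel₀} (θ-isCongruence : IsCongruence θ) (θ-fi : FullyInvariant θ) where

    open CongruenceProperties θ-isCongruence using (θ⇒θZ−)
    open FromFullyInvariant θ-isCongruence θ-fi using () renaming (z/θ⇔I+N to z/θ⇔Iθ+Nθ)

    -- θ is generated by the pairs (z, g) for the generators g of I and of N modulo I M_𝓤.
    finitelyGenerated : FinGenIdeal (Iθ θ) × FinGenQuotient (Nθ θ) (Iθ θ) → FinGenFI θ
    finitelyGenerated ((GI , I⊇GI , I-least) , (GN , N⊇GN , N-spanned)) =
      map (Z ,_) (GI ++ GN) , map⁺ (++⁺ (All.map proj₁ I⊇GI) (All.map proj₁ N⊇GN)) , θ⊆ψ
      where
      θ⊆ψ : ∀ ψ → IsCongruence ψ → FullyInvariant ψ → All (uncurry ψ) (map (Z ,_) (GI ++ GN)) → ∀ s t → θ s t → ψ s t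
      θ⊆ψ ψ ψ-isCongruence ψ-fi ψ⊇gens s t θst =
        θZ−⇒θ (Equivalence.from (z/θ⇔I+N _) (Iθ+Nθ⊆Iψ+Nψ (Equivalence.to (z/θ⇔Iθ+Nθ _) (θ⇒θZ− θst))))
        where
        open FromFullyInvariant ψ-isCongruence ψ-fi
        open CongruenceProperties ψ-isCongruence using (θZ−⇒θ)
        module Nψ = IsSubmodule N-isSubmodule

        ψZ⊇GI = proj₁ (++⁻ GI (map⁻ ψ⊇gens))
        ψZ⊇GN = proj₂ (++⁻ GI (map⁻ ψ⊇gens))

        Iθ⊆Iψ : ∀ t → Iθ θ t → Iθ ψ t
        Iθ⊆Iψ = I-least (Iθ ψ) I-isIdeal (All.zipWith (λ (ψZg , (_ , g∈R)) → ψZg , g∈R) (ψZ⊇GI , I⊇GI))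

        sumProd∈Nψ : ∀ l → All (λ p → InR (proj₁ p) × proj₂ p ∈ GN) l → Nθ ψ (sumProd l)
        sumProd∈Nψ []            []                = Nψ.zero
        sumProd∈Nψ ((a , g) ∷ l) ((a∈R , g∈GN) ∷ l∈) =
          Nψ.+-cl _ _ (Nψ.act-cl a g a∈R (All.lookup (All.zipWith (λ (ψZg , (_ , g∈M)) → ψZg , g∈M) (ψZ⊇GN , N⊇GN)) g∈GN))
                      (sumProd∈Nψ l l∈)

        Nθ⊆Nψ : ∀ t → Nθ θ t → Nθ ψ t
        Nθ⊆Nψ t t∈Nθ with N-spanned t t∈Nθ
        ... | l , l∈ , t−l∈IM =
          Nψ.resp _ _ (solve ((‵ 0 ⊕̂ ⊖̂ ‵ 1) ⊕̂ ‵ 1) (‵ 0) tt (t ∷ sumProd l ∷ []))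
                  (Nψ.+-cl _ _ (IM⊆N _ (InIM-mono Iθ⊆Iψ t−l∈IM)) (sumProd∈Nψ l l∈))

        Iθ+Nθ⊆Iψ+Nψ : ∀ {t} → (Σ F λ a → Σ F λ b → Iθ θ a × Nθ θ b × (t ≈U a ⊕ b)) →
                               (Σ F λ a → Σ F λ b → Iθ ψ a × Nθ ψ b × (t ≈U a ⊕ b))
        Iθ+Nθ⊆Iψ+Nψ (a , b , a∈Iθ , b∈Nθ , t≈a⊕b) = a , b , Iθ⊆Iψ a a∈Iθ , Nθ⊆Nψ b b∈Nθ , t≈a⊕b

  finitelyGenerated⇔ : Part5
  finitelyGenerated⇔ θ θ-isCongruence θ-fi =
    mk⇔ (FromFinitelyGenerated.finitelyGenerated θ-isCongruence θ-fi)
        (FromFinitelyGeneratedParts.finitelyGenerated θ-isCongruence θ-fi)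

lemma3p2 : (ℓ n : ℕ) (ℓ≤n : ℓ ≤ n) → Variety.Lemma3p2 ℓ n ℓ≤n
lemma3p2 ℓ n ℓ≤n = record
  { part1-malcev  = Algebras.isMalcev ℓ n ℓ≤n
  ; part1-abelian = Algebras.isAbelian ℓ n ℓ≤n
  ; part2         = FreeRing.isFreeRing ℓ n ℓ≤n
  ; part3         = FreeModule.isFreeModule ℓ n ℓ≤n
  ; part4         = FullyInvariantCongruences.fullyInvariant⇔conditions ℓ n ℓ≤n
  ; part5         = FiniteGeneration.finitelyGenerated⇔ ℓ n ℓ≤n
  }
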